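{- Let $m,n\ge1$ and let \[ \mathcal S'_m=\big(\{m\}\times(\mathbb{Z}\cap(-\infty,0])\big)\cup\big((\mathbb{Z}\cap(-\infty,m-1])\times(\mathbb{Z}\cap(-\infty,1])\big). \] There is a bijection between intervals of $\mathbb{D}'_{m,n}$ and walks in $\mathbb{N}^2$ starting from $(0,0)$ consisting of $n-1$ steps from $\mathcal S'_m$, such that a walk ending at $(i,j)$ corresponds to an interval $[P,Q]$ where $P$ has first ascent of length $m+i$ and $r(P,Q)=1+j$. Consequently, there is also a bijection between intervals of $\mathbb{D}'_{m,n}$ and walks in $\mathbb{N}^2$ of length $n$ with steps in $\mathcal S'_m$ starting and ending at $(0,0)$.
   Context: Dyck paths of size $N$: lattice paths from $(0,0)$ with $N$ steps $U=(1,1)$ and $N$ steps $D=(1,-1)$, ending on the $x$-axis, never below it. An ascent (resp. descent) is a maximal run of up (resp. down) steps; $c(P)$ lists the ascent lengths of $P$. $\mathbb{D}_N$: Dyck paths of size $N$ ordered by the reflexive-transitive closure of replacing a factor $DU^kD$ ($k\ge1$) by $U^kDD$; if $P\le Q$ then $c(P)$ refines $c(Q)$. $\mathbb{D}'_{m,n}$: Dyck paths of size $mn$ whose descent lengths are all multiples of $m$, with the order induced from $\mathbb{D}_{mn}$. For $P\le Q$ with $c(P)=(c_1,\dots)$, $c(Q)=(d_1,\dots)$, $r(P,Q)$ is the unique $r$ with $c_1+\cdots+c_r=d_1$. A walk in $\mathbb{N}^2$ has all its points with nonnegative coordinates. -}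

module Defs where

open import Data.Bool using (Bool; true; false; T; if_then_else_)
open import Data.Nat using (ℕ; zero; suc; _+_; _*_; _∸_; _≤_)
open import Data.Nat.Divisibility using (_∣_)
open import Data.Integer as ℤ using (ℤ; +_; 0ℤ)
open import Data.List using (List; []; _∷_; _++_; replicate; length; take)
open import Data.Nat.ListAction using (sum)
open import Data.List.Relation.Unary.All using (All)
open import Data.Product using (_×_; _,_; Σ; ∃; ∃-syntax)
open import Data.Sum using (_⊎_)
open import Relation.Binary.PropositionalEquality using (_≡_)
open import Relation.Binary.Construct.Closure.ReflexiveTransitive using (Star)

-- Paths: true = U = (1,1), false = D = (1,-1)

Path : Set
Path = List Bool

dyckFrom : ℕ → Path → Bool
dyckFrom zero    []          = true
dyckFrom (suc h) []          = false
dyckFrom h       (true ∷ p)  = dyckFrom (suc h) p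
dyckFrom zero    (false ∷ p) = false
dyckFrom (suc h) (false ∷ p) = dyckFrom h p

IsDyck : ℕ → Path → Set
IsDyck N p = (length p ≡ 2 * N) × T (dyckFrom 0 p)

-- lengths of the maximal runs of the letter b (acc = length of the current run)
runsFrom : Bool → ℕ → Path → List ℕ
runsFrom b zero    []       = []
runsFrom b (suc a) []       = suc a ∷ []
runsFrom true  a (true ∷ p)  = runsFrom true (suc a) p
runsFrom false a (false ∷ p) = runsFrom false (suc a) p
runsFrom true  zero    (false ∷ p) = runsFrom true zero p
runsFrom true  (suc a) (false ∷ p) = suc a ∷ runsFrom true zero p
runsFrom false zero    (true ∷ p)  = runsFrom false zero p
runsFrom false (suc a) (true ∷ p)  = suc a ∷ runsFrom false zero p

ascents : Path → List ℕ
ascents = runsFrom true 0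

descents : Path → List ℕ
descents = runsFrom false 0

headOr0 : List ℕ → ℕ
headOr0 []      = 0
headOr0 (x ∷ _) = x

firstAscent : Path → ℕ
firstAscent p = headOr0 (ascents p)

data Cover : Path → Path → Set where
  cover : (a b : Path) (k : ℕ) → 1 ≤ k →
          Cover (a ++ (false ∷ replicate k true ++ false ∷ b))
                (a ++ (replicate k true ++ false ∷ false ∷ b))

_≤D_ : Path → Path → Set
_≤D_ = Star Cover

InD' : ℕ → ℕ → Path → Set
InD' m n p = IsDyck (m * n) p × All (m ∣_) (descents p)

-- r(P,Q) = r : c_1 + ... + c_r = d_1 (r ≤ number of ascents of P;
-- since ascents are positive this r is unique)
IsR : Path → Path → ℕ → Set
IsR P Q r = (r ≤ length (ascents P)) × (sum (take r (ascents P)) ≡ firstAscent Q)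

-- intervals [P,Q] of D'_{m,n}; proofs are irrelevant, so two intervals are
-- equal iff their endpoints are equal
record Interval (m n : ℕ) : Set where
  constructor interval
  field
    bot top : Path
    .botIn : InD' m n bot
    .topIn : InD' m n top
    .le    : bot ≤D top
open Interval public

Pt : Set
Pt = ℤ × ℤ

_⊕_ : Pt → Pt → Pt
(a , b) ⊕ (c , d) = (a ℤ.+ c , b ℤ.+ d)

InS' : ℕ → Pt → Set
InS' m (a , b) = (a ≡ + m × b ℤ.≤ 0ℤ) ⊎ (a ℤ.≤ + m ℤ.- + 1 × b ℤ.≤ + 1)

points : Pt → List Pt → List Pt
points s []       = s ∷ []
points s (x ∷ xs) = s ∷ points (s ⊕ x) xs

endpoint : Pt → List Pt → Pt
endpoint s []       = s
endpoint s (x ∷ xs) = endpoint (s ⊕ x) xs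

InN2 : Pt → Set
InN2 (a , b) = (0ℤ ℤ.≤ a) × (0ℤ ℤ.≤ b)

origin : Pt
origin = (0ℤ , 0ℤ)

record Walk (m ℓ : ℕ) : Set where
  constructor walk
  field
    steps : List Pt
    .len     : length steps ≡ ℓ
    .inS     : All (InS' m) steps
    .inQuad  : All InN2 (points origin steps)
open Walk public

walkEnd : ∀ {m ℓ} → Walk m ℓ → Pt
walkEnd w = endpoint origin (steps w)

record Excursion (m ℓ : ℕ) : Set where
  constructor excursion
  field
    path : Walk m ℓ
    .closed : walkEnd path ≡ origin

module Submission where

-- A Dyck path is determined by its code, which lists for every up step the number of down steps
-- before it, and P ≤ Q holds exactly when the code of Q lies pointwise below the code of P and is
-- constant on every run of equal entries of the code of P.
-- An interval [P, Q] of D′_{m,n+1} arises from one of D′_{m,n} by a growth step: both paths get m more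
-- up steps in front, P gets m down steps after its first m + i up steps, and Q gets them at the end of
-- its new first ascent, which has to cover exactly the first j + 1 ascents of the new P. Dropping the
-- first m entries of both codes undoes this, and the pairs (i, j) that yield an interval are exactly the
-- points reached from the label (first ascent of P − m, r(P, Q) − 1) of the smaller interval by a step
-- of S′_m. Shrinking an interval down to the unique interval of size 1 therefore records a walk in ℕ²
-- that ends at its label; an excursion is such a walk followed by the forced step back to the origin.

open import Data.Bool using (Bool; true; false; T)
import Data.Bool as Bool
open import Data.Empty using (⊥; ⊥-elim)
open import Data.Integer as ℤ using (ℤ; 0ℤ; _⊖_; ∣_∣; +≤+)
import Data.Integer.Properties as ℤ
open import Data.Integer.Tactic.RingSolver using (solve-∀)
open import Data.List using (List; []; _∷_; _++_; replicate; length; take; drop; map)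
open import Data.List.Properties
  using (length-++; length-replicate; length-map; length-take; length-drop; ++-identityʳ;
         take++drop≡id; drop-map; drop-drop; drop-all; ≡-dec)
open import Data.List.Relation.Binary.Pointwise as Pointwise using (Pointwise; []; _∷_)
open import Data.List.Relation.Unary.All as All using (All; []; _∷_)
open import Data.List.Relation.Unary.All.Properties using (++⁺; take⁺)
open import Data.Nat
open import Data.Nat.Divisibility using (_∣_; ∣-refl; ∣m∣n⇒∣m+n; ∣m+n∣m⇒∣n; _∣0; ∣⇒≤; m∣m*n)
open import Data.Nat.ListAction using (sum)
open import Data.Nat.Properties
open import Algebra.Properties.CommutativeSemigroup +-commutativeSemigroup using (x∙yz≈y∙xz)
open import Data.Product using (Σ; Σ-syntax; _×_; _,_; proj₁; proj₂)
import Data.Product.Properties as Product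
open import Data.Sum using (_⊎_; inj₁; inj₂; [_,_]′)
open import Data.Unit using (⊤; tt)
open import Function.Bundles using (_⤖_; Bijection; _↔_; mk↔ₛ′)
open import Function.Properties.Inverse using (↔⇒⤖)
open import Function.Construct.Composition using (_↔-∘_)
open import Relation.Binary.Definitions using (tri<; tri≈; tri>)
open import Relation.Binary.Construct.Closure.ReflexiveTransitive using (ε; _◅_; _◅◅_)
open import Relation.Binary.PropositionalEquality
open import Relation.Nullary using (¬_; yes; no; Dec)
open import Relation.Nullary.Decidable using (recompute; _×-dec_)

open import Defs

∸≡suc∸suc : ∀ N d → d < N → N ∸ d ≡ suc (N ∸ suc d)
∸≡suc∸suc (suc N) zero    _       = refl
∸≡suc∸suc (suc N) (suc d) (s≤s h) = ∸≡suc∸suc N d h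

∸-injective-above : ∀ c x x' → x ∸ c ≡ x' ∸ c → (x ≡ x') ⊎ (x ≤ c × x' ≤ c)
∸-injective-above c x x' e with x ≤? c | x' ≤? c
... | yes p | yes q = inj₂ (p , q)
... | yes p | no q  = ⊥-elim (q (m∸n≡0⇒m≤n (trans (sym e) (m≤n⇒m∸n≡0 p))))
... | no p  | yes q = ⊥-elim (p (m∸n≡0⇒m≤n (trans e (m≤n⇒m∸n≡0 q))))
... | no p  | no q  = inj₁ (∸-cancelʳ-≡ (≰⇒≥ p) (≰⇒≥ q) e)

∣-∸ : ∀ {d m n} → n ≤ m → d ∣ m → d ∣ n → d ∣ m ∸ n
∣-∸ n≤m d∣m d∣n = ∣m+n∣m⇒∣n (subst (_ ∣_) (sym (m+[n∸m]≡n n≤m)) d∣m) d∣n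

∣<⇒≡0 : ∀ {m} x → m ∣ x → x < m → x ≡ 0
∣<⇒≡0 zero    _   _   = refl
∣<⇒≡0 (suc x) m∣x x<m = ⊥-elim (<⇒≱ x<m (∣⇒≤ m∣x))

∣⇒∣∸ : ∀ {m} x → m ∣ x → m ∣ x ∸ m
∣⇒∣∸ {m} x m∣x with m ≤? x
... | yes m≤x = ∣-∸ m≤x m∣x ∣-refl
... | no m≰x  = subst (m ∣_) (sym (m≤n⇒m∸n≡0 (<⇒≤ (≰⇒> m≰x)))) (m ∣0)

double-injective : ∀ a b → a + a ≡ b + b → a ≡ b
double-injective a b e with <-cmp a b
... | tri< a<b _ _ = ⊥-elim (<⇒≢ (+-mono-< a<b a<b) e)
... | tri≈ _ a≡b _ = a≡b
... | tri> _ _ a>b = ⊥-elim (<⇒≢ (+-mono-< a>b a>b) (sym e))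

m∸n+[n∸o]≡m∸o : ∀ {m n o} → o ≤ n → n ≤ m → (m ∸ n) + (n ∸ o) ≡ m ∸ o
m∸n+[n∸o]≡m∸o {m} {n} {o} o≤n n≤m = trans (sym (+-∸-assoc (m ∸ n) o≤n)) (cong (_∸ o) (m∸n+n≡m n≤m))

m+[[n∸m]+o]≡n+o : ∀ m n o → m ≤ n → m + ((n ∸ m) + o) ≡ n + o
m+[[n∸m]+o]≡n+o m n o m≤n = trans (sym (+-assoc m (n ∸ m) o)) (cong (_+ o) (m+[n∸m]≡n m≤n))

replicate-snoc : ∀ {A : Set} k (x : A) l → replicate k x ++ x ∷ l ≡ x ∷ replicate k x ++ l
replicate-snoc zero    x l = refl
replicate-snoc (suc k) x l = cong (x ∷_) (replicate-snoc k x l)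

length-replicate-++ : ∀ {A : Set} k (x : A) l → length (replicate k x ++ l) ≡ k + length l
length-replicate-++ k x l = trans (length-++ (replicate k x)) (cong (_+ length l) (length-replicate k))

take-replicate-++ : ∀ {A : Set} k n (v : A) l → take (k + n) (replicate k v ++ l) ≡ replicate k v ++ take n l
take-replicate-++ zero    n v l = refl
take-replicate-++ (suc k) n v l = cong (v ∷_) (take-replicate-++ k n v l)

drop-replicate-++ : ∀ {A : Set} k n (v : A) l → drop (k + n) (replicate k v ++ l) ≡ drop n l
drop-replicate-++ zero    n v l = refl
drop-replicate-++ (suc k) n v l = drop-replicate-++ k n v l

drop-replicate-+ : ∀ {A : Set} k s (v : A) l → drop k (replicate (k + s) v ++ l) ≡ replicate s v ++ l
drop-replicate-+ zero    s v l = refl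
drop-replicate-+ (suc k) s v l = drop-replicate-+ k s v l

drop-replicate : ∀ {A : Set} k (v : A) l → drop k (replicate k v ++ l) ≡ l
drop-replicate zero    v l = refl
drop-replicate (suc k) v l = drop-replicate k v l

take-length-++ : ∀ {A : Set} (a b : List A) → take (length a) (a ++ b) ≡ a
take-length-++ []      b = refl
take-length-++ (x ∷ a) b = cong (x ∷_) (take-length-++ a b)

length-take-≤ : ∀ {A : Set} k (l : List A) → k ≤ length l → length (take k l) ≡ k
length-take-≤ k l h = trans (length-take k l) (m≤n⇒m⊓n≡m h)

sum-take-mono : ∀ bs t j → t ≤ j → sum (take t bs) ≤ sum (take j bs)
sum-take-mono bs       zero    j       _       = z≤n
sum-take-mono []       (suc t) (suc j) _       = z≤n
sum-take-mono (b ∷ bs) (suc t) (suc j) (s≤s h) = +-monoʳ-≤ b (sum-take-mono bs t j h)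

sum-take-mono⁻ : ∀ bs t j → All (0 <_) bs → t ≤ length bs → sum (take t bs) ≤ sum (take j bs) → t ≤ j
sum-take-mono⁻ bs       zero    j       _          _       _ = z≤n
sum-take-mono⁻ (b ∷ bs) (suc t) zero    (b>0 ∷ _)  _       h = ⊥-elim (<⇒≱ (≤-trans b>0 (m≤m+n b _)) h)
sum-take-mono⁻ (b ∷ bs) (suc t) (suc j) (_ ∷ bs>0) (s≤s l) h =
  s≤s (sum-take-mono⁻ bs t j bs>0 l (+-cancelˡ-≤ b _ _ h))

sum-take-positive : ∀ bs t → All (0 <_) bs → suc t ≤ length bs → 0 < sum (take (suc t) bs)
sum-take-positive (b ∷ bs) t (b>0 ∷ _) _ = ≤-trans b>0 (m≤m+n b _)

leadingZeros : List ℕ → ℕ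
leadingZeros []          = 0
leadingZeros (zero ∷ l)  = suc (leadingZeros l)
leadingZeros (suc _ ∷ l) = 0

-- runLengthsFrom v c l: the run lengths of replicate c v ++ l.
runLengthsFrom : ℕ → ℕ → List ℕ → List ℕ
runLengthsFrom v c [] = c ∷ []
runLengthsFrom v c (y ∷ l) with v ≟ y
... | yes _ = runLengthsFrom v (suc c) l
... | no _  = c ∷ runLengthsFrom y 1 l

runLengths : List ℕ → List ℕ
runLengths []      = []
runLengths (x ∷ l) = runLengthsFrom x 1 l

runsWithin : List ℕ → ℕ → ℕ
runsWithin [] f = 0
runsWithin (b ∷ bs) f with b ≤? f
... | yes _ = suc (runsWithin bs (f ∸ b))
... | no _  = 0

lastFrom : ℕ → List ℕ → ℕ
lastFrom v []      = v
lastFrom v (y ∷ l) = lastFrom y l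

HeadNot : ℕ → List ℕ → Set
HeadNot v []      = ⊤
HeadNot v (y ∷ _) = v ≢ y

Separated : List ℕ → List ℕ → Set
Separated []      b = ⊤
Separated (x ∷ a) b = HeadNot (lastFrom x a) b

lastFrom-++ : ∀ v a y b → lastFrom v (a ++ y ∷ b) ≡ lastFrom y b
lastFrom-++ v []      y b = refl
lastFrom-++ v (x ∷ a) y b = lastFrom-++ x a y b

lastFrom-replicate : ∀ k v → lastFrom v (replicate k v) ≡ v
lastFrom-replicate zero    v = refl
lastFrom-replicate (suc k) v = lastFrom-replicate k v

Separated-++ : ∀ a y a' b → Separated (a ++ y ∷ a') b ≡ Separated (y ∷ a') b
Separated-++ []      y a' b = refl
Separated-++ (x ∷ a) y a' b = cong (λ w → HeadNot w b) (lastFrom-++ x a y a')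

Separated-[]ʳ : ∀ a → Separated a []
Separated-[]ʳ []      = tt
Separated-[]ʳ (x ∷ a) = tt

Separated-prefix : ∀ a K y l b → 0 < K → Separated (take K (y ∷ l)) b → Separated (a ++ take K (y ∷ l)) b
Separated-prefix a (suc K) y l b _ s rewrite Separated-++ a y (take K l) b = s

runLengthsFrom-replicate : ∀ v c k l → runLengthsFrom v c (replicate k v ++ l) ≡ runLengthsFrom v (c + k) l
runLengthsFrom-replicate v c zero l = cong (λ w → runLengthsFrom v w l) (sym (+-identityʳ c))
runLengthsFrom-replicate v c (suc k) l with v ≟ v
... | yes _ = trans (runLengthsFrom-replicate v (suc c) k l) (cong (λ w → runLengthsFrom v w l) (sym (+-suc c k)))
... | no v≢v = ⊥-elim (v≢v refl)

runLengthsFrom-HeadNot : ∀ v c l → HeadNot v l → runLengthsFrom v c l ≡ c ∷ runLengths l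
runLengthsFrom-HeadNot v c []      h = refl
runLengthsFrom-HeadNot v c (y ∷ l) h with v ≟ y
... | yes v≡y = ⊥-elim (h v≡y)
... | no _    = refl

runLengths-replicate : ∀ k v l → 1 ≤ k → HeadNot v l → runLengths (replicate k v ++ l) ≡ k ∷ runLengths l
runLengths-replicate (suc k) v l _ h = trans (runLengthsFrom-replicate v 1 k l) (runLengthsFrom-HeadNot v (suc k) l h)

runLengthsFrom-++ : ∀ v c a b → HeadNot (lastFrom v a) b →
                    runLengthsFrom v c (a ++ b) ≡ runLengthsFrom v c a ++ runLengths b
runLengthsFrom-++ v c []      b h = runLengthsFrom-HeadNot v c b h
runLengthsFrom-++ v c (y ∷ a) b h with v ≟ y
... | yes refl = runLengthsFrom-++ v (suc c) a b h
... | no _     = cong (c ∷_) (runLengthsFrom-++ y 1 a b h)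

runLengths-++ : ∀ a b → Separated a b → runLengths (a ++ b) ≡ runLengths a ++ runLengths b
runLengths-++ []      b h = refl
runLengths-++ (x ∷ a) b h = runLengthsFrom-++ x 1 a b h

runLengths-map-+ : ∀ c l → runLengths (map (c +_) l) ≡ runLengths l
runLengths-map-+ c []      = refl
runLengths-map-+ c (x ∷ l) = go x 1 l
  where
  go : ∀ v k l → runLengthsFrom (c + v) k (map (c +_) l) ≡ runLengthsFrom v k l
  go v k [] = refl
  go v k (y ∷ l) with (c + v) ≟ (c + y) | v ≟ y
  ... | yes _ | yes _   = go v (suc k) l
  ... | no _  | no _    = cong (k ∷_) (go y 1 l)
  ... | yes e | no v≢y  = ⊥-elim (v≢y (+-cancelˡ-≡ c v y e))
  ... | no e  | yes v≡y = ⊥-elim (e (cong (c +_) v≡y))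

sum-runLengths : ∀ l → sum (runLengths l) ≡ length l
sum-runLengths []      = refl
sum-runLengths (x ∷ l) = go x 1 l
  where
  go : ∀ v c l → sum (runLengthsFrom v c l) ≡ c + length l
  go v c [] = refl
  go v c (y ∷ l) with v ≟ y
  ... | yes _ = trans (go v (suc c) l) (sym (+-suc c (length l)))
  ... | no _  = cong (c +_) (go y 1 l)

runLengths-positive : ∀ l → All (0 <_) (runLengths l)
runLengths-positive []      = []
runLengths-positive (x ∷ l) = go x 0 l
  where
  go : ∀ v c l → All (0 <_) (runLengthsFrom v (suc c) l)
  go v c [] = s≤s z≤n ∷ []
  go v c (y ∷ l) with v ≟ y
  ... | yes _ = go v (suc c) l
  ... | no _  = s≤s z≤n ∷ go y 0 l

runLengths-nonempty : ∀ k l → 1 ≤ k → k ≤ length l → 1 ≤ length (runLengths (take k l))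
runLengths-nonempty (suc k) (x ∷ l) _ _ = go x 1 (take k l)
  where
  go : ∀ v c l → 1 ≤ length (runLengthsFrom v c l)
  go v c [] = s≤s z≤n
  go v c (y ∷ l) with v ≟ y
  ... | yes _ = go v (suc c) l
  ... | no _  = s≤s z≤n

runsWithin-sum-take : ∀ bs t → All (0 <_) bs → t ≤ length bs → runsWithin bs (sum (take t bs)) ≡ t
runsWithin-sum-take []       zero    _          _ = refl
runsWithin-sum-take (b ∷ bs) zero    (b>0 ∷ _)  _ with b ≤? 0
... | yes b≤0 = ⊥-elim (<⇒≱ b>0 b≤0)
... | no _    = refl
runsWithin-sum-take (b ∷ bs) (suc t) (_ ∷ bs>0) (s≤s t≤) with b ≤? b + sum (take t bs)
... | yes _ = cong suc (trans (cong (runsWithin bs) (m+n∸m≡n b _)) (runsWithin-sum-take bs t bs>0 t≤))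
... | no b≰ = ⊥-elim (b≰ (m≤m+n b _))

separated-at-runs : ∀ t l → t ≤ length (runLengths l) →
  let K = sum (take t (runLengths l)) in Separated (take K l) (drop K l)
separated-at-runs zero    l       _ = tt
separated-at-runs (suc t) (x ∷ l) h = go x 0 l (suc t) h
  where
  go : ∀ v c l t → t ≤ length (runLengthsFrom v (suc c) l) →
       let K = sum (take t (runLengthsFrom v (suc c) l)) ; L = replicate (suc c) v ++ l in
       Separated (take K L) (drop K L)
  go v c l zero _ = tt
  go v c [] (suc zero) _ =
    subst₂ Separated (sym (take-replicate-++ (suc c) 0 v [])) (sym (drop-replicate-++ (suc c) 0 v []))
      (Separated-[]ʳ (replicate (suc c) v ++ []))
  go v c [] (suc (suc t)) (s≤s ())
  go v c (y ∷ l) (suc t) h with v ≟ y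
  ... | yes refl = subst (λ L → Separated (take K L) (drop K L)) (sym (cong (v ∷_) (replicate-snoc c v l)))
                     (go v (suc c) l (suc t) h)
    where K = sum (take (suc t) (runLengthsFrom v (suc (suc c)) l))
  go v c (y ∷ l) (suc zero) _ | no v≢y =
    subst₂ Separated (sym (take-replicate-++ (suc c) 0 v (y ∷ l))) (sym (drop-replicate-++ (suc c) 0 v (y ∷ l)))
      (subst (λ w → HeadNot w (y ∷ l))
        (sym (trans (cong (lastFrom v) (++-identityʳ (replicate c v))) (lastFrom-replicate c v))) v≢y)
  go v c (y ∷ l) (suc (suc t)) (s≤s h) | no _ =
    subst₂ Separated (sym (take-replicate-++ (suc c) K v (y ∷ l))) (sym (drop-replicate-++ (suc c) K v (y ∷ l)))
      (Separated-prefix (replicate (suc c) v) K y l _ (sum-take-positive _ t (runLengths-positive (y ∷ l)) h)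
        (go y 0 l (suc t) h))
    where K = sum (take (suc t) (runLengthsFrom y 1 l))

runsWithin-at-boundary : ∀ k l → k ≤ length l → Separated (take k l) (drop k l) →
  let r = length (runLengths (take k l)) in
  r ≤ length (runLengths l) × sum (take r (runLengths l)) ≡ k × runsWithin (runLengths l) k ≡ r
runsWithin-at-boundary k l k≤ sep = r≤ , sum≡ , trans (cong (runsWithin (runLengths l)) (sym sum≡))
                                                       (runsWithin-sum-take (runLengths l) r (runLengths-positive l) r≤)
  where
  A = take k l
  B = drop k l
  r = length (runLengths A)
  runs : runLengths l ≡ runLengths A ++ runLengths B
  runs = trans (cong runLengths (sym (take++drop≡id k l))) (runLengths-++ A B sep)
  r≤ : r ≤ length (runLengths l)
  r≤ = subst (λ w → r ≤ length w) (sym runs) (subst (r ≤_) (sym (length-++ (runLengths A))) (m≤m+n r _))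
  sum≡ : sum (take r (runLengths l)) ≡ k
  sum≡ = trans (cong (λ w → sum (take r w)) runs)
           (trans (cong sum (take-length-++ (runLengths A) (runLengths B))) (trans (sum-runLengths A) (length-take-≤ k l k≤)))

leadingZeros-replicate : ∀ k l → leadingZeros (replicate k 0 ++ l) ≡ k + leadingZeros l
leadingZeros-replicate zero    l = refl
leadingZeros-replicate (suc k) l = cong suc (leadingZeros-replicate k l)

leadingZeros-prefix : ∀ s l → s ≤ leadingZeros l → replicate s 0 ++ drop s l ≡ l
leadingZeros-prefix zero    l          _       = refl
leadingZeros-prefix (suc s) (zero ∷ l) (s≤s h) = cong (0 ∷_) (leadingZeros-prefix s l h)

leadingZeros-split : ∀ l → l ≡ replicate (leadingZeros l) 0 ++ drop (leadingZeros l) l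
leadingZeros-split l = sym (leadingZeros-prefix (leadingZeros l) l ≤-refl)

leadingZeros≤length : ∀ l → leadingZeros l ≤ length l
leadingZeros≤length []          = z≤n
leadingZeros≤length (zero ∷ l)  = s≤s (leadingZeros≤length l)
leadingZeros≤length (suc x ∷ l) = z≤n

HeadNot-drop-leadingZeros : ∀ l → HeadNot 0 (drop (leadingZeros l) l)
HeadNot-drop-leadingZeros []          = tt
HeadNot-drop-leadingZeros (zero ∷ l)  = HeadNot-drop-leadingZeros l
HeadNot-drop-leadingZeros (suc x ∷ l) = λ ()

HeadNot-below : ∀ d v l → d < v → All (v ≤_) l → HeadNot d l
HeadNot-below d v []      _   _           = tt
HeadNot-below d v (x ∷ l) d<v (v≤x ∷ _) e = 1+n≰n (≤-trans d<v (subst (v ≤_) (sym e) v≤x))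

leadingZeros-drop : ∀ k l → leadingZeros l ∸ k ≤ leadingZeros (drop k l)
leadingZeros-drop zero    l           = ≤-refl
leadingZeros-drop (suc k) []          = z≤n
leadingZeros-drop (suc k) (zero ∷ l)  = leadingZeros-drop k l
leadingZeros-drop (suc k) (suc x ∷ l) = z≤n

leadingZeros-map-∸ : ∀ c l → leadingZeros l ≤ leadingZeros (map (_∸ c) l)
leadingZeros-map-∸ c []          = z≤n
leadingZeros-map-∸ c (zero ∷ l)  rewrite 0∸n≡0 c = s≤s (leadingZeros-map-∸ c l)
leadingZeros-map-∸ c (suc x ∷ l) = z≤n

runLengths-leadingZeros : ∀ l → 1 ≤ leadingZeros l →
  runLengths l ≡ leadingZeros l ∷ runLengths (drop (leadingZeros l) l)
runLengths-leadingZeros l h =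
  trans (cong runLengths (leadingZeros-split l)) (runLengths-replicate (leadingZeros l) 0 _ h (HeadNot-drop-leadingZeros l))

Glued : List ℕ → List ℕ → Set
Glued []           b       = ⊥
Glued (x ∷ [])     []      = ⊥
Glued (x ∷ [])     (y ∷ b) = x ≡ y
Glued (x ∷ x' ∷ a) b       = Glued (x' ∷ a) b

¬Glued⇒Separated : ∀ a b → ¬ Glued a b → Separated a b
¬Glued⇒Separated []           b       _ = tt
¬Glued⇒Separated (x ∷ [])     []      _ = tt
¬Glued⇒Separated (x ∷ [])     (y ∷ b) n = n
¬Glued⇒Separated (x ∷ x' ∷ a) b       n = ¬Glued⇒Separated (x' ∷ a) b n

Separated⇒¬Glued : ∀ a b → Separated a b → ¬ Glued a b
Separated⇒¬Glued (x ∷ [])     (y ∷ b) s e = s e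
Separated⇒¬Glued (x ∷ x' ∷ a) b       s e = Separated⇒¬Glued (x' ∷ a) b s e

Glued-replicate : ∀ k v l → HeadNot v l → ¬ Glued (replicate k v) l
Glued-replicate (suc zero)    v (y ∷ l) h e = h e
Glued-replicate (suc (suc k)) v l       h e = Glued-replicate (suc k) v l h e

Glued-≤ : ∀ a y b δ → All (_≤ δ) a → Glued a (y ∷ b) → y ≤ δ
Glued-≤ (x ∷ [])     y b δ (x≤δ ∷ _) e = subst (_≤ δ) e x≤δ
Glued-≤ (x ∷ x' ∷ a) y b δ (_ ∷ a≤δ) e = Glued-≤ (x' ∷ a) y b δ a≤δ e

RunsRefine : List ℕ → List ℕ → Set
RunsRefine (x ∷ x' ∷ l) (y ∷ y' ∷ k) = (x ≡ x' → y ≡ y') × RunsRefine (x' ∷ l) (y' ∷ k)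
RunsRefine _            _            = ⊤

_≼_ : List ℕ → List ℕ → Set
l ≼ k = Pointwise _≥_ l k × RunsRefine l k

Pointwise-≥-refl : ∀ l → Pointwise _≥_ l l
Pointwise-≥-refl l = Pointwise.refl ≤-refl

≥-replicate-0 : ∀ l → Pointwise _≥_ l (replicate (length l) 0)
≥-replicate-0 []      = []
≥-replicate-0 (x ∷ l) = z≤n ∷ ≥-replicate-0 l

Pointwise-≥-drop-replicate : ∀ k v w l l' →
  Pointwise _≥_ (replicate k v ++ l) (replicate k w ++ l') → Pointwise _≥_ l l'
Pointwise-≥-drop-replicate zero    v w l l' le       = le
Pointwise-≥-drop-replicate (suc k) v w l l' (_ ∷ le) = Pointwise-≥-drop-replicate k v w l l' le

leadingZeros-mono : ∀ l k → Pointwise _≥_ l k → leadingZeros l ≤ leadingZeros k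
leadingZeros-mono []          []          []                  = z≤n
leadingZeros-mono (zero ∷ l)  (zero ∷ k)  (_ ∷ lk)            = s≤s (leadingZeros-mono l k lk)
leadingZeros-mono (suc x ∷ l) (y ∷ k)     _                   = z≤n

RunsRefine-refl : ∀ l → RunsRefine l l
RunsRefine-refl []           = tt
RunsRefine-refl (x ∷ [])     = tt
RunsRefine-refl (x ∷ x' ∷ l) = (λ e → e) , RunsRefine-refl (x' ∷ l)

RunsRefine-[]ʳ : ∀ l → RunsRefine l []
RunsRefine-[]ʳ []          = tt
RunsRefine-[]ʳ (_ ∷ [])    = tt
RunsRefine-[]ʳ (_ ∷ _ ∷ _) = tt

RunsRefine-tail : ∀ x l y k → RunsRefine (x ∷ l) (y ∷ k) → RunsRefine l k
RunsRefine-tail x []       y k        r       = tt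
RunsRefine-tail x (x' ∷ l) y []       r       = RunsRefine-[]ʳ (x' ∷ l)
RunsRefine-tail x (x' ∷ l) y (y' ∷ k) (_ , r) = r

RunsRefine-cons : ∀ v w l k → HeadNot v l → RunsRefine l k → RunsRefine (v ∷ l) (w ∷ k)
RunsRefine-cons v w []      k       h r = tt
RunsRefine-cons v w (x ∷ l) []      h r = tt
RunsRefine-cons v w (x ∷ l) (y ∷ k) h r = (λ e → ⊥-elim (h e)) , r

RunsRefine-replicateʳ : ∀ l n v → RunsRefine l (replicate n v)
RunsRefine-replicateʳ (x ∷ x' ∷ l) (suc (suc n)) v = (λ _ → refl) , RunsRefine-replicateʳ (x' ∷ l) (suc n) v
RunsRefine-replicateʳ []           n             v = tt
RunsRefine-replicateʳ (x ∷ [])     n             v = tt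
RunsRefine-replicateʳ (x ∷ x' ∷ l) zero          v = tt
RunsRefine-replicateʳ (x ∷ x' ∷ l) (suc zero)    v = tt

RunsRefine-trans : ∀ a b c → Pointwise _≥_ a b → RunsRefine a b → RunsRefine b c → RunsRefine a c
RunsRefine-trans (x ∷ x' ∷ a) (y ∷ y' ∷ b) (w ∷ w' ∷ c) (_ ∷ ab) (p , r) (q , s) =
  (λ e → q (p e)) , RunsRefine-trans (x' ∷ a) (y' ∷ b) (w' ∷ c) ab r s
RunsRefine-trans []           b            c            _ _ _ = tt
RunsRefine-trans (x ∷ [])     b            c            _ _ _ = tt
RunsRefine-trans (x ∷ x' ∷ a) (y ∷ y' ∷ b) []           _ _ _ = tt
RunsRefine-trans (x ∷ x' ∷ a) (y ∷ y' ∷ b) (w ∷ [])     _ _ _ = tt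
RunsRefine-trans (x ∷ x' ∷ a) (y ∷ [])     c            (_ ∷ ()) _ _

RunsRefine-++ : ∀ a b c d → length a ≡ length c → RunsRefine a c → RunsRefine b d →
                (Glued a b → Glued c d) → RunsRefine (a ++ b) (c ++ d)
RunsRefine-++ []           b        []           d        _ _ r _ = r
RunsRefine-++ (x ∷ [])     []       (y ∷ [])     d        _ _ _ _ = tt
RunsRefine-++ (x ∷ [])     (x' ∷ b) (y ∷ [])     []       _ _ _ _ = tt
RunsRefine-++ (x ∷ [])     (x' ∷ b) (y ∷ [])     (y' ∷ d) _ _ r j = j , r
RunsRefine-++ (x ∷ x' ∷ a) b        (y ∷ y' ∷ c) d        e (p , r) s j =
  p , RunsRefine-++ (x' ∷ a) b (y' ∷ c) d (suc-injective e) r s j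

RunsRefine-++⁻ : ∀ a b c d → length a ≡ length c → length b ≡ length d →
                 RunsRefine (a ++ b) (c ++ d) → Glued a b → Glued c d
RunsRefine-++⁻ (x ∷ [])     (x' ∷ b) (y ∷ [])     (y' ∷ d) _ _  (j , _) e = j e
RunsRefine-++⁻ (x ∷ x' ∷ a) b        (y ∷ y' ∷ c) d        e e' (_ , r) j =
  RunsRefine-++⁻ (x' ∷ a) b (y' ∷ c) d (suc-injective e) e' r j

RunsRefine-drop-replicate : ∀ k v w l l' → RunsRefine (replicate (suc k) v ++ l) (replicate (suc k) w ++ l') →
                            RunsRefine (v ∷ l) (w ∷ l')
RunsRefine-drop-replicate zero    v w l l' r       = r
RunsRefine-drop-replicate (suc k) v w l l' (_ , r) = RunsRefine-drop-replicate k v w l l' r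

RunsRefine-map-+ : ∀ c l k → RunsRefine l k → RunsRefine (map (c +_) l) (map (c +_) k)
RunsRefine-map-+ c (x ∷ x' ∷ l) (y ∷ y' ∷ k) (p , r) =
  (λ e → cong (c +_) (p (+-cancelˡ-≡ c x x' e))) , RunsRefine-map-+ c (x' ∷ l) (y' ∷ k) r
RunsRefine-map-+ c []           k            _ = tt
RunsRefine-map-+ c (x ∷ [])     k            _ = tt
RunsRefine-map-+ c (x ∷ x' ∷ l) []           _ = tt
RunsRefine-map-+ c (x ∷ x' ∷ l) (y ∷ [])     _ = tt

RunsRefine-map-∸ : ∀ c l k → Pointwise _≥_ l k → RunsRefine l k → RunsRefine (map (_∸ c) l) (map (_∸ c) k)
RunsRefine-map-∸ c (x ∷ x' ∷ l) (y ∷ y' ∷ k) (y≤x ∷ y'≤x' ∷ lk) (p , r) =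
  f , RunsRefine-map-∸ c (x' ∷ l) (y' ∷ k) (y'≤x' ∷ lk) r
  where
  f : x ∸ c ≡ x' ∸ c → y ∸ c ≡ y' ∸ c
  f e with ∸-injective-above c x x' e
  ... | inj₁ x≡x'         = cong (_∸ c) (p x≡x')
  ... | inj₂ (x≤c , x'≤c) =
    trans (m≤n⇒m∸n≡0 (≤-trans y≤x x≤c)) (sym (m≤n⇒m∸n≡0 (≤-trans y'≤x' x'≤c)))
RunsRefine-map-∸ c []           k            _ _ = tt
RunsRefine-map-∸ c (x ∷ [])     k            _ _ = tt
RunsRefine-map-∸ c (x ∷ x' ∷ l) []           _ _ = tt
RunsRefine-map-∸ c (x ∷ x' ∷ l) (y ∷ [])     _ _ = tt

≼-refl : ∀ l → l ≼ l
≼-refl l = Pointwise-≥-refl l , RunsRefine-refl l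

≼-trans : ∀ a b c → a ≼ b → b ≼ c → a ≼ c
≼-trans a b c (ab , r) (bc , s) = Pointwise.transitive (λ p q → ≤-trans q p) ab bc , RunsRefine-trans a b c ab r s

≼-drop : ∀ j l k → l ≼ k → drop j l ≼ drop j k
≼-drop zero    l       k       lk              = lk
≼-drop (suc j) []      []      _               = [] , tt
≼-drop (suc j) (x ∷ l) (y ∷ k) (_ ∷ g , r) = ≼-drop j l k (g , RunsRefine-tail x l y k r)

≼-map-∸ : ∀ c l k → l ≼ k → map (_∸ c) l ≼ map (_∸ c) k
≼-map-∸ c l k (g , r) =
  Pointwise.map⁺ _ _ (Pointwise.map (∸-monoˡ-≤ c) g) , RunsRefine-map-∸ c l k g r

≼-separates-leadingZeros : ∀ lP lQ → lP ≼ lQ → Separated (take (leadingZeros lQ) lP) (drop (leadingZeros lQ) lP)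
≼-separates-leadingZeros lP lQ (le , r) =
  ¬Glued⇒Separated A B (λ g → Glued-replicate z 0 Q₂ (HeadNot-drop-leadingZeros lQ)
    (RunsRefine-++⁻ A B (replicate z 0) Q₂ (trans lengthA (sym (length-replicate z))) lengthB r′ g))
  where
  z  = leadingZeros lQ
  A  = take z lP
  B  = drop z lP
  Q₂ = drop z lQ
  lengthA : length A ≡ z
  lengthA = length-take-≤ z lP (subst (z ≤_) (sym (Pointwise.Pointwise-length le)) (leadingZeros≤length lQ))
  lengthB : length B ≡ length Q₂
  lengthB = trans (length-drop z lP) (trans (cong (_∸ z) (Pointwise.Pointwise-length le)) (sym (length-drop z lQ)))
  r′ : RunsRefine (A ++ B) (replicate z 0 ++ Q₂)
  r′ = subst₂ RunsRefine (sym (take++drop≡id z lP)) (leadingZeros-split lQ) r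

downs : Path → ℕ
downs []          = 0
downs (true ∷ p)  = downs p
downs (false ∷ p) = suc (downs p)

ups : Path → ℕ
ups []          = 0
ups (true ∷ p)  = suc (ups p)
ups (false ∷ p) = ups p

codeFrom : ℕ → Path → List ℕ
codeFrom d []          = []
codeFrom d (true ∷ p)  = d ∷ codeFrom d p
codeFrom d (false ∷ p) = codeFrom (suc d) p

code : Path → List ℕ
code = codeFrom 0

-- decodeFrom d l N: the path after d down steps with code l (counted from d), padded with
-- down steps up to N in total.
decodeFrom : ℕ → List ℕ → ℕ → Path
decodeFrom d []      N = replicate (N ∸ d) false
decodeFrom d (x ∷ l) N = replicate (x ∸ d) false ++ true ∷ decodeFrom x l N

decode : List ℕ → ℕ → Path
decode = decodeFrom 0

SortedUpTo : ℕ → ℕ → List ℕ → Set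
SortedUpTo N d []      = d ≤ N
SortedUpTo N d (x ∷ l) = d ≤ x × SortedUpTo N x l

SortedBelow : ℕ → ℕ → List ℕ → Set
SortedBelow N d []      = d < N
SortedBelow N d (x ∷ l) = d ≤ x × SortedBelow N x l

UnderDiagonal : ℕ → List ℕ → Set
UnderDiagonal k []      = ⊤
UnderDiagonal k (x ∷ l) = x ≤ k × UnderDiagonal (suc k) l

downs-downs-++ : ∀ k p → downs (replicate k false ++ p) ≡ k + downs p
downs-downs-++ zero    p = refl
downs-downs-++ (suc k) p = cong suc (downs-downs-++ k p)

downs-ups-++ : ∀ k p → downs (replicate k true ++ p) ≡ downs p
downs-ups-++ zero    p = refl
downs-ups-++ (suc k) p = downs-ups-++ k p

length≡ups+downs : ∀ p → length p ≡ ups p + downs p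
length≡ups+downs []          = refl
length≡ups+downs (true ∷ p)  = cong suc (length≡ups+downs p)
length≡ups+downs (false ∷ p) = trans (cong suc (length≡ups+downs p)) (sym (+-suc (ups p) (downs p)))

codeFrom-downs : ∀ d k p → codeFrom d (replicate k false ++ p) ≡ codeFrom (k + d) p
codeFrom-downs d zero    p = refl
codeFrom-downs d (suc k) p = trans (codeFrom-downs (suc d) k p) (cong (λ w → codeFrom w p) (+-suc k d))

codeFrom-only-downs : ∀ d k → codeFrom d (replicate k false) ≡ []
codeFrom-only-downs d zero    = refl
codeFrom-only-downs d (suc k) = codeFrom-only-downs (suc d) k

codeFrom-ups : ∀ d k p → codeFrom d (replicate k true ++ p) ≡ replicate k d ++ codeFrom d p
codeFrom-ups d zero    p = refl
codeFrom-ups d (suc k) p = cong (d ∷_) (codeFrom-ups d k p)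

codeFrom-++ : ∀ d p q → codeFrom d (p ++ q) ≡ codeFrom d p ++ codeFrom (downs p + d) q
codeFrom-++ d []          q = refl
codeFrom-++ d (true ∷ p)  q = cong (d ∷_) (codeFrom-++ d p q)
codeFrom-++ d (false ∷ p) q =
  trans (codeFrom-++ (suc d) p q) (cong (λ w → codeFrom (suc d) p ++ codeFrom w q) (+-suc (downs p) d))

codeFrom-≤ : ∀ d p → All (_≤ downs p + d) (codeFrom d p)
codeFrom-≤ d []          = []
codeFrom-≤ d (true ∷ p)  = m≤n+m d (downs p) ∷ codeFrom-≤ d p
codeFrom-≤ d (false ∷ p) = subst (λ w → All (_≤ w) (codeFrom (suc d) p)) (+-suc (downs p) d) (codeFrom-≤ (suc d) p)

codeFrom-≥ : ∀ d p → All (d ≤_) (codeFrom d p)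
codeFrom-≥ d []          = []
codeFrom-≥ d (true ∷ p)  = ≤-refl ∷ codeFrom-≥ d p
codeFrom-≥ d (false ∷ p) = All.map (≤-trans (n≤1+n d)) (codeFrom-≥ (suc d) p)

length-codeFrom : ∀ d p → length (codeFrom d p) ≡ ups p
length-codeFrom d []          = refl
length-codeFrom d (true ∷ p)  = cong suc (length-codeFrom d p)
length-codeFrom d (false ∷ p) = length-codeFrom (suc d) p

SortedUpTo-weaken : ∀ N e e' l → e' ≤ e → SortedUpTo N e l → SortedUpTo N e' l
SortedUpTo-weaken N e e' []      h s       = ≤-trans h s
SortedUpTo-weaken N e e' (x ∷ l) h (a , s) = ≤-trans h a , s

SortedUpTo-codeFrom : ∀ d p → SortedUpTo (downs p + d) d (codeFrom d p)
SortedUpTo-codeFrom d []          = ≤-refl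
SortedUpTo-codeFrom d (true ∷ p)  = ≤-refl , SortedUpTo-codeFrom d p
SortedUpTo-codeFrom d (false ∷ p) =
  subst (λ w → SortedUpTo w d (codeFrom (suc d) p)) (+-suc (downs p) d)
    (SortedUpTo-weaken _ (suc d) d (codeFrom (suc d) p) (n≤1+n d) (SortedUpTo-codeFrom (suc d) p))

SortedUpTo-top : ∀ N x l → SortedUpTo N x l → x ≤ N
SortedUpTo-top N x []      s       = s
SortedUpTo-top N x (y ∷ l) (a , s) = ≤-trans a (SortedUpTo-top N y l s)

SortedBelow⇒SortedUpTo : ∀ N d l → SortedBelow N d l → SortedUpTo N d l
SortedBelow⇒SortedUpTo N d []      h       = <⇒≤ h
SortedBelow⇒SortedUpTo N d (x ∷ l) (a , s) = a , SortedBelow⇒SortedUpTo N x l s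

codeFrom-decodeFrom : ∀ N d l → SortedUpTo N d l → codeFrom d (decodeFrom d l N) ≡ l
codeFrom-decodeFrom N d []      h       = codeFrom-only-downs d (N ∸ d)
codeFrom-decodeFrom N d (x ∷ l) (h , s) =
  trans (codeFrom-downs d (x ∸ d) _)
    (trans (cong (λ w → codeFrom w (true ∷ decodeFrom x l N)) (m∸n+n≡m h)) (cong (x ∷_) (codeFrom-decodeFrom N x l s)))

decodeFrom-shift : ∀ N d l → SortedUpTo N (suc d) l → decodeFrom d l N ≡ false ∷ decodeFrom (suc d) l N
decodeFrom-shift N d []      h       = cong (λ w → replicate w false) (∸≡suc∸suc N d h)
decodeFrom-shift N d (x ∷ l) (h , _) = cong (λ w → replicate w false ++ true ∷ decodeFrom x l N) (∸≡suc∸suc x d h)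

decodeFrom-codeFrom : ∀ d p → decodeFrom d (codeFrom d p) (downs p + d) ≡ p
decodeFrom-codeFrom d []          = cong (λ w → replicate w false) (n∸n≡0 d)
decodeFrom-codeFrom d (true ∷ p)  =
  trans (cong (λ w → replicate w false ++ true ∷ decodeFrom d (codeFrom d p) (downs p + d)) (n∸n≡0 d))
        (cong (true ∷_) (decodeFrom-codeFrom d p))
decodeFrom-codeFrom d (false ∷ p) =
  trans (decodeFrom-shift (suc (downs p) + d) d (codeFrom (suc d) p) sorted)
        (cong (false ∷_) (trans (cong (decodeFrom (suc d) (codeFrom (suc d) p)) (sym (+-suc (downs p) d)))
                                (decodeFrom-codeFrom (suc d) p)))
  where
  sorted : SortedUpTo (suc (downs p) + d) (suc d) (codeFrom (suc d) p)
  sorted = subst (λ w → SortedUpTo w (suc d) (codeFrom (suc d) p)) (+-suc (downs p) d) (SortedUpTo-codeFrom (suc d) p)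

length-decodeFrom : ∀ N d l → SortedUpTo N d l → length (decodeFrom d l N) ≡ length l + (N ∸ d)
length-decodeFrom N d []      h       = length-replicate (N ∸ d)
length-decodeFrom N d (x ∷ l) (h , s) = begin
  length (replicate (x ∸ d) false ++ true ∷ decodeFrom x l N) ≡⟨ length-replicate-++ (x ∸ d) false _ ⟩
  (x ∸ d) + suc (length (decodeFrom x l N))
    ≡⟨ cong (λ w → (x ∸ d) + suc w) (length-decodeFrom N x l s) ⟩
  (x ∸ d) + suc (length l + (N ∸ x))                          ≡⟨ +-suc (x ∸ d) _ ⟩
  suc ((x ∸ d) + (length l + (N ∸ x)))                        ≡⟨ cong suc (x∙yz≈y∙xz (x ∸ d) (length l) (N ∸ x)) ⟩
  suc (length l + ((x ∸ d) + (N ∸ x)))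
    ≡⟨ cong (λ w → suc (length l + w)) (trans (+-comm (x ∸ d) _) (m∸n+[n∸o]≡m∸o h (SortedUpTo-top N x l s))) ⟩
  suc (length l + (N ∸ d))                                    ∎
  where open ≡-Reasoning

UnderDiagonal-codeFrom : ∀ h d p → T (dyckFrom h p) → UnderDiagonal (h + d) (codeFrom d p)
UnderDiagonal-codeFrom h       d []          t = tt
UnderDiagonal-codeFrom zero    d (true ∷ p)  t = m≤n+m d 0 , UnderDiagonal-codeFrom 1 d p t
UnderDiagonal-codeFrom (suc h) d (true ∷ p)  t = m≤n+m d (suc h) , UnderDiagonal-codeFrom (suc (suc h)) d p t
UnderDiagonal-codeFrom (suc h) d (false ∷ p) t =
  subst (λ w → UnderDiagonal w (codeFrom (suc d) p)) (+-suc h d) (UnderDiagonal-codeFrom h (suc d) p t)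

dyckFrom-balance : ∀ h p → T (dyckFrom h p) → h + ups p ≡ downs p
dyckFrom-balance zero    []          t = refl
dyckFrom-balance zero    (true ∷ p)  t = dyckFrom-balance 1 p t
dyckFrom-balance (suc h) (true ∷ p)  t = trans (+-suc (suc h) (ups p)) (dyckFrom-balance (suc (suc h)) p t)
dyckFrom-balance (suc h) (false ∷ p) t = cong suc (dyckFrom-balance h p t)

dyckFrom-downs : ∀ j i p → dyckFrom (j + i) (replicate i false ++ p) ≡ dyckFrom j p
dyckFrom-downs j zero    p = cong (λ w → dyckFrom w p) (+-identityʳ j)
dyckFrom-downs j (suc i) p =
  trans (cong (λ w → dyckFrom w (false ∷ replicate i false ++ p)) (+-suc j i)) (dyckFrom-downs j i p)

dyckFrom-up : ∀ h p → dyckFrom h (true ∷ p) ≡ dyckFrom (suc h) p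
dyckFrom-up zero    p = refl
dyckFrom-up (suc h) p = refl

dyckFrom-decodeFrom : ∀ N k d l → SortedUpTo N d l → UnderDiagonal k l → d ≤ k → k + length l ≡ N →
                      T (dyckFrom (k ∸ d) (decodeFrom d l N))
dyckFrom-decodeFrom N k d [] s b h e rewrite sym e | +-identityʳ k = all-downs (k ∸ d)
  where
  all-downs : ∀ j → T (dyckFrom j (replicate j false))
  all-downs zero    = tt
  all-downs (suc j) = all-downs j
dyckFrom-decodeFrom N k d (x ∷ l) (d≤x , s) (x≤k , b) h e =
  subst T (sym (trans (cong (λ w → dyckFrom w (replicate (x ∸ d) false ++ true ∷ decodeFrom x l N)) split)
                      (dyckFrom-downs (k ∸ x) (x ∸ d) (true ∷ decodeFrom x l N))))
    (subst T (sym (dyckFrom-up (k ∸ x) (decodeFrom x l N)))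
      (subst (λ w → T (dyckFrom w (decodeFrom x l N))) (+-∸-assoc 1 x≤k)
        (dyckFrom-decodeFrom N (suc k) x l s b (≤-trans x≤k (n≤1+n k)) (trans (sym (+-suc k (length l))) e))))
  where
  split : k ∸ d ≡ (k ∸ x) + (x ∸ d)
  split = sym (m∸n+[n∸o]≡m∸o d≤x x≤k)

codeFrom-divisible : ∀ m a d p → a ≤ d → m ∣ d ∸ a → All (m ∣_) (runsFrom false a p) → All (m ∣_) (codeFrom d p)
codeFrom-divisible m a       d []          h m∣ _           = []
codeFrom-divisible m zero    d (true ∷ p)  h m∣ ds          = m∣ ∷ codeFrom-divisible m 0 d p z≤n m∣ ds
codeFrom-divisible m (suc a) d (true ∷ p)  h m∣ (m∣a ∷ ds)  = m∣d ∷ codeFrom-divisible m 0 d p z≤n m∣d ds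
  where
  m∣d : m ∣ d
  m∣d = subst (m ∣_) (m∸n+n≡m h) (∣m∣n⇒∣m+n m∣ m∣a)
codeFrom-divisible m zero    d (false ∷ p) h m∣ ds          = codeFrom-divisible m 1 (suc d) p (s≤s h) m∣ ds
codeFrom-divisible m (suc a) d (false ∷ p) h m∣ ds          = codeFrom-divisible m (suc (suc a)) (suc d) p (s≤s h) m∣ ds

runsFrom-downs : ∀ a k p → runsFrom false a (replicate k false ++ p) ≡ runsFrom false (k + a) p
runsFrom-downs a       zero    p = refl
runsFrom-downs zero    (suc k) p = trans (runsFrom-downs 1 k p) (cong (λ w → runsFrom false w p) (+-suc k 0))
runsFrom-downs (suc a) (suc k) p =
  trans (runsFrom-downs (suc (suc a)) k p) (cong (λ w → runsFrom false w p) (+-suc k (suc a)))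

descents-decodeFrom : ∀ m N d l → m ∣ d → SortedUpTo N d l → All (m ∣_) l → m ∣ N →
                      All (m ∣_) (descents (decodeFrom d l N))
descents-decodeFrom m N d [] m∣d s _ m∣N =
  subst (All (m ∣_)) (sym (trans (cong descents (sym (++-identityʳ (replicate (N ∸ d) false))))
                              (trans (runsFrom-downs 0 (N ∸ d) [])
                                     (cong (λ w → runsFrom false w []) (+-identityʳ (N ∸ d))))))
    (last-run (N ∸ d) (∣-∸ s m∣N m∣d))
  where
  last-run : ∀ a → m ∣ a → All (m ∣_) (runsFrom false a [])
  last-run zero    _   = []
  last-run (suc a) m∣a = m∣a ∷ []
descents-decodeFrom m N d (x ∷ l) m∣d (h , s) (m∣x ∷ m∣l) m∣N =
  subst (All (m ∣_)) (sym (trans (runsFrom-downs 0 (x ∸ d) _)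
                              (cong (λ w → runsFrom false w (true ∷ decodeFrom x l N)) (+-identityʳ (x ∸ d)))))
    (step (x ∸ d) (∣-∸ h m∣x m∣d))
  where
  step : ∀ a → m ∣ a → All (m ∣_) (runsFrom false a (true ∷ decodeFrom x l N))
  step zero    _   = descents-decodeFrom m N x l m∣x s m∣l m∣N
  step (suc a) m∣a = m∣a ∷ descents-decodeFrom m N x l m∣x s m∣l m∣N

ascents-downs : ∀ k p → ascents (replicate k false ++ p) ≡ ascents p
ascents-downs zero    p = refl
ascents-downs (suc k) p = ascents-downs k p

ascents-decode : ∀ N l → SortedBelow N 0 l → ascents (decode l N) ≡ runLengths l
ascents-decode N []      h = trans (cong ascents (sym (++-identityʳ (replicate N false)))) (ascents-downs N [])
ascents-decode N (x ∷ l) (_ , s) = trans (ascents-downs x (true ∷ decodeFrom x l N)) (go x 0 l s)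
  where
  go : ∀ x c l → SortedBelow N x l → runsFrom true (suc c) (decodeFrom x l N) ≡ runLengthsFrom x (suc c) l
  go x c [] h =
    trans (cong (λ w → runsFrom true (suc c) (replicate w false)) (∸≡suc∸suc N x h))
          (cong (suc c ∷_) (trans (cong ascents (sym (++-identityʳ (replicate (N ∸ suc x) false))))
                                  (ascents-downs (N ∸ suc x) [])))
  go x c (y ∷ l) (h , s) with x ≟ y
  ... | yes refl =
    trans (cong (λ w → runsFrom true (suc c) (replicate w false ++ true ∷ decodeFrom x l N)) (n∸n≡0 x)) (go x (suc c) l s)
  ... | no x≢y =
    trans (cong (λ w → runsFrom true (suc c) (replicate w false ++ true ∷ decodeFrom y l N))
                (∸≡suc∸suc y x (≤∧≢⇒< h x≢y)))
          (cong (suc c ∷_) (trans (ascents-downs (y ∸ suc x) (true ∷ decodeFrom y l N)) (go y 0 l s)))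

cover⇒≼ : ∀ a b k → 1 ≤ k →
  code (a ++ false ∷ replicate k true ++ false ∷ b) ≼ code (a ++ replicate k true ++ false ∷ false ∷ b)
cover⇒≼ a b k 1≤k
  rewrite codeFrom-++ 0 a (false ∷ replicate k true ++ false ∷ b)
        | codeFrom-++ 0 a (replicate k true ++ false ∷ false ∷ b)
        | codeFrom-ups (suc (downs a + 0)) k (false ∷ b)
        | codeFrom-ups (downs a + 0) k (false ∷ false ∷ b) =
  Pointwise.++⁺ (Pointwise-≥-refl A) (Pointwise.++⁺ (Pointwise.replicate⁺ (n≤1+n δ) k) (Pointwise-≥-refl X)) ,
  RunsRefine-++ A _ A _ refl (RunsRefine-refl A)
    (RunsRefine-++ (replicate k (suc δ)) X (replicate k δ) X (trans (length-replicate k) (sym (length-replicate k)))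
       (RunsRefine-replicateʳ _ k δ) (RunsRefine-refl X) (λ g → ⊥-elim (Glued-replicate k (suc δ) X X-fresh g)))
    (λ g → ⊥-elim (not-glued k 1≤k g))
  where
  δ = downs a + 0
  A = codeFrom 0 a
  X = codeFrom (suc (suc δ)) b
  X-fresh : HeadNot (suc δ) X
  X-fresh with X | codeFrom-≥ (suc (suc δ)) b
  ... | []    | _       = tt
  ... | _ ∷ _ | (q ∷ _) = λ e → 1+n≰n (subst (suc (suc δ) ≤_) (sym e) q)
  not-glued : ∀ k → 1 ≤ k → ¬ Glued A (replicate k (suc δ) ++ X)
  not-glued (suc k) _ g = 1+n≰n (Glued-≤ A (suc δ) _ δ (codeFrom-≤ 0 a) g)

≤D⇒≼ : ∀ P Q → P ≤D Q → code P ≼ code Q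
≤D⇒≼ P .P ε = ≼-refl (code P)
≤D⇒≼ P Q (_◅_ {j = R} (cover a b k 1≤k) R≤Q) =
  ≼-trans (code P) (code R) (code Q) (cover⇒≼ a b k 1≤k) (≤D⇒≼ R Q R≤Q)

≤D-cons : ∀ c {P Q} → P ≤D Q → (c ∷ P) ≤D (c ∷ Q)
≤D-cons c ε                         = ε
≤D-cons c (cover a b k 1≤k ◅ R≤Q) = cover (c ∷ a) b k 1≤k ◅ ≤D-cons c R≤Q

≤D-prefix : ∀ pre {P Q} → P ≤D Q → (pre ++ P) ≤D (pre ++ Q)
≤D-prefix []        P≤Q = P≤Q
≤D-prefix (c ∷ pre) P≤Q = ≤D-cons c (≤D-prefix pre P≤Q)

ascent-left : ∀ e k b →
  (replicate e false ++ replicate (suc k) true ++ false ∷ b) ≤D (replicate (suc k) true ++ replicate (suc e) false ++ b)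
ascent-left zero    k b = ε
ascent-left (suc e) k b =
  subst (_≤D (replicate (suc k) true ++ replicate (suc (suc e)) false ++ b))
    (replicate-snoc e false (replicate (suc k) true ++ false ∷ b))
    (cover (replicate e false) b (suc k) (s≤s z≤n) ◅
      subst (λ w → (replicate e false ++ replicate (suc k) true ++ false ∷ false ∷ b) ≤D (replicate (suc k) true ++ w))
        (replicate-snoc (suc e) false b) (ascent-left e k (false ∷ b)))

EndsWithDown : Path → Set
EndsWithDown []          = ⊤
EndsWithDown (c ∷ [])    = c ≡ false
EndsWithDown (_ ∷ c ∷ p) = EndsWithDown (c ∷ p)

EndsWithDown-tail : ∀ c p → EndsWithDown (c ∷ p) → EndsWithDown p
EndsWithDown-tail c []      _ = tt
EndsWithDown-tail c (_ ∷ p) e = e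

EndsWithDown-suffix : ∀ p q → EndsWithDown (p ++ q) → EndsWithDown q
EndsWithDown-suffix []      q e = e
EndsWithDown-suffix (c ∷ p) q e = EndsWithDown-suffix p q (EndsWithDown-tail c (p ++ q) e)

EndsWithDown-prefix : ∀ p c q → EndsWithDown (c ∷ q) → EndsWithDown (p ++ c ∷ q)
EndsWithDown-prefix []           c q e = e
EndsWithDown-prefix (_ ∷ [])     c q e = e
EndsWithDown-prefix (_ ∷ c' ∷ p) c q e = EndsWithDown-prefix (c' ∷ p) c q e

ups-then-down : ∀ P → EndsWithDown P → 0 < length P → Σ ℕ λ k → Σ Path λ b → P ≡ replicate k true ++ false ∷ b
ups-then-down (false ∷ P)    _ _ = 0 , P , refl
ups-then-down (true ∷ c ∷ P) e _ with ups-then-down (c ∷ P) e (s≤s z≤n)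
... | k , b , eq = suc k , b , cong (true ∷_) eq

downs-ups-down : ∀ P → 0 < ups P → EndsWithDown P →
  Σ ℕ λ e → Σ ℕ λ k → Σ Path λ b → P ≡ replicate e false ++ replicate (suc k) true ++ false ∷ b
downs-ups-down (false ∷ P)    u e with downs-ups-down P u (EndsWithDown-tail false P e)
... | e′ , k , b , eq = suc e′ , k , b , cong (false ∷_) eq
downs-ups-down (true ∷ c ∷ P) _ e with ups-then-down (c ∷ P) e (s≤s z≤n)
... | k , b , eq = 0 , k , b , cong (true ∷_) eq

codeFrom-suc-≰ : ∀ d l Q → ¬ Pointwise _≥_ (d ∷ l) (codeFrom (suc d) Q)
codeFrom-suc-≰ d l Q le with codeFrom (suc d) Q | codeFrom-≥ (suc d) Q
codeFrom-suc-≰ d l Q (y≤d ∷ _) | y ∷ _ | d<y ∷ _ = 1+n≰n (≤-trans d<y y≤d)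

-- The k + 1 equal entries of P's code force equal entries, that is up steps, in Q's code.
ups-follow : ∀ k v l d Q → Pointwise _≥_ (replicate (suc k) v ++ l) (d ∷ codeFrom d Q) →
             RunsRefine (replicate (suc k) v ++ l) (d ∷ codeFrom d Q) → Σ Path λ Q₂ → Q ≡ replicate k true ++ Q₂
ups-follow zero    v l d Q           _        _       = Q , refl
ups-follow (suc k) v l d (true ∷ Q)  (_ ∷ le) (_ , r) with ups-follow k v l d Q le r
... | Q₂ , eq = Q₂ , cong (true ∷_) eq
ups-follow (suc k) v l d (false ∷ Q) le       r       with codeFrom (suc d) Q | codeFrom-≥ (suc d) Q
ups-follow (suc k) v l d (false ∷ Q) (_ ∷ ()) r       | []    | _
ups-follow (suc k) v l d (false ∷ Q) _        (f , _) | y ∷ _ | d<y ∷ _ =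
  ⊥-elim (1+n≰n (subst (suc d ≤_) (sym (f refl)) d<y))

RunsRefineAfter : Bool → ℕ → List ℕ → List ℕ → Set
RunsRefineAfter true  d l k = RunsRefine (d ∷ l) (d ∷ k)
RunsRefineAfter false d l k = RunsRefine l k

RunsRefineAfter⇒RunsRefine : ∀ u d l k → RunsRefineAfter u d l k → RunsRefine l k
RunsRefineAfter⇒RunsRefine true  d l k r = RunsRefine-tail d l d k r
RunsRefineAfter⇒RunsRefine false d l k r = r

-- ≼⇒≤D with fuel n; the flag u records whether the previous step of both paths was an up step
-- at code d.
≼⇒≤D-Fuel : ℕ → Set
≼⇒≤D-Fuel n = ∀ d u P Q → length P ≤ n → Pointwise _≥_ (codeFrom d P) (codeFrom d Q) →
  RunsRefineAfter u d (codeFrom d P) (codeFrom d Q) → downs P ≡ downs Q → EndsWithDown P → P ≤D Q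

-- P has a down step where Q has an up step: P's next ascent is moved left, then the paths agree on
-- a common prefix of up steps.
≼⇒≤D-down-up : ∀ n → ≼⇒≤D-Fuel n → ∀ d u e k b Q →
  let P = replicate e false ++ replicate (suc k) true ++ false ∷ b in
  length P ≤ n → Pointwise _≥_ (codeFrom (suc d) P) (d ∷ codeFrom d Q) →
  RunsRefineAfter u d (codeFrom (suc d) P) (d ∷ codeFrom d Q) → downs (false ∷ P) ≡ downs (true ∷ Q) →
  EndsWithDown (false ∷ P) → (false ∷ P) ≤D (true ∷ Q)
≼⇒≤D-down-up n ih d u e k b Q length≤ le r downs≡ ends = finish (ups-follow k v X d Q le′ r′)
  where
  v = e + suc d
  X = codeFrom (suc v) b
  codeP : codeFrom (suc d) (replicate e false ++ replicate (suc k) true ++ false ∷ b) ≡ replicate (suc k) v ++ X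
  codeP = trans (codeFrom-downs (suc d) e _) (codeFrom-ups v (suc k) (false ∷ b))
  le′ : Pointwise _≥_ (replicate (suc k) v ++ X) (d ∷ codeFrom d Q)
  le′ = subst (λ w → Pointwise _≥_ w (d ∷ codeFrom d Q)) codeP le
  r′ : RunsRefine (replicate (suc k) v ++ X) (d ∷ codeFrom d Q)
  r′ = subst (λ w → RunsRefine w (d ∷ codeFrom d Q)) codeP (RunsRefineAfter⇒RunsRefine u d _ _ r)
  P′ = replicate (suc (suc e)) false ++ b
  codeP′ : codeFrom d P′ ≡ X
  codeP′ = trans (codeFrom-downs d (suc (suc e)) b) (cong (λ w → codeFrom (suc w) b) (sym (+-suc e d)))
  finish : (Σ Path λ Q₂ → Q ≡ replicate k true ++ Q₂) →
           (false ∷ replicate e false ++ replicate (suc k) true ++ false ∷ b) ≤D (true ∷ Q)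
  finish (Q₂ , refl) = ascent-left (suc e) k b ◅◅ ≤D-prefix (replicate (suc k) true) P′≤Q₂
    where
    Y = codeFrom d Q₂
    codeQ : codeFrom d (true ∷ replicate k true ++ Q₂) ≡ replicate (suc k) d ++ Y
    codeQ = codeFrom-ups d (suc k) Q₂
    X≥Y : Pointwise _≥_ X Y
    X≥Y = Pointwise-≥-drop-replicate (suc k) v d X Y (subst (Pointwise _≥_ (replicate (suc k) v ++ X)) codeQ le′)
    X∼Y : RunsRefine X Y
    X∼Y = RunsRefine-tail v X d Y
            (RunsRefine-drop-replicate k v d X Y (subst (RunsRefine (replicate (suc k) v ++ X)) codeQ r′))
    X-fresh : HeadNot d X
    X-fresh = HeadNot-below d (suc v) X (s≤s (≤-trans (n≤1+n d) (m≤n+m (suc d) e))) (codeFrom-≥ (suc v) b)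
    downsP′ : downs P′ ≡ downs Q₂
    downsP′ = begin
      downs P′                                              ≡⟨ downs-downs-++ (suc (suc e)) b ⟩
      suc (suc e) + downs b                                 ≡⟨ cong suc (sym (+-suc e (downs b))) ⟩
      suc (e + suc (downs b))                               ≡⟨ cong (λ w → suc (e + w)) (sym (downs-ups-++ (suc k) _)) ⟩
      suc (e + downs (replicate (suc k) true ++ false ∷ b)) ≡⟨ cong suc (sym (downs-downs-++ e _)) ⟩
      downs (false ∷ replicate e false ++ replicate (suc k) true ++ false ∷ b)
        ≡⟨ downs≡ ⟩
      downs (replicate k true ++ Q₂)                        ≡⟨ downs-ups-++ k Q₂ ⟩
      downs Q₂                                              ∎
      where open ≡-Reasoning
    lengthP′ : length P′ ≤ n
    lengthP′ = ≤-trans shorter length≤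
      where
      open ≤-Reasoning
      B = length b
      shorter : length P′ ≤ length (replicate e false ++ replicate (suc k) true ++ false ∷ b)
      shorter = begin
        length P′                                         ≡⟨ length-replicate-++ (suc (suc e)) false b ⟩
        suc (suc e) + B                                   ≡⟨ sym (trans (+-suc e (suc B)) (cong suc (+-suc e B))) ⟩
        e + (1 + suc B)                                   ≤⟨ +-monoʳ-≤ e (+-monoˡ-≤ (suc B) (s≤s z≤n)) ⟩
        e + (suc k + suc B)                               ≡⟨ cong (e +_) (sym (length-replicate-++ (suc k) true _)) ⟩
        e + length (replicate (suc k) true ++ false ∷ b)  ≡⟨ sym (length-replicate-++ e false _) ⟩
        length (replicate e false ++ replicate (suc k) true ++ false ∷ b) ∎
    endsP′ : EndsWithDown P′
    endsP′ = subst EndsWithDown (replicate-snoc (suc e) false b)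
               (EndsWithDown-prefix (replicate (suc e) false) false b
                 (EndsWithDown-suffix (replicate (suc k) true) (false ∷ b)
                   (EndsWithDown-suffix (false ∷ replicate e false) (replicate (suc k) true ++ false ∷ b) ends)))
    P′≤Q₂ : P′ ≤D Q₂
    P′≤Q₂ = ih d true P′ Q₂ lengthP′ (subst (λ w → Pointwise _≥_ w Y) (sym codeP′) X≥Y)
              (subst (λ w → RunsRefine (d ∷ w) (d ∷ Y)) (sym codeP′) (RunsRefine-cons d d X Y X-fresh X∼Y))
              downsP′ endsP′

≼⇒≤D-fuel : ∀ n → ≼⇒≤D-Fuel n
≼⇒≤D-fuel n       d u []          []          _         _        _ _      _    = ε
≼⇒≤D-fuel n       d u []          (false ∷ Q) _         _        _ ()     _
≼⇒≤D-fuel zero    d u (_ ∷ P)     Q           ()        _        _ _      _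
≼⇒≤D-fuel (suc n) d u (true ∷ P)  (true ∷ Q)  (s≤s len) (_ ∷ le) r downs≡ ends =
  ≤D-cons true (≼⇒≤D-fuel n d true P Q len le (RunsRefineAfter⇒RunsRefine u d _ _ r) downs≡
                  (EndsWithDown-tail true P ends))
≼⇒≤D-fuel (suc n) d u (false ∷ P) (false ∷ Q) (s≤s len) le       r downs≡ ends =
  ≤D-cons false (≼⇒≤D-fuel n (suc d) false P Q len le (RunsRefineAfter⇒RunsRefine u d _ _ r) (suc-injective downs≡)
                  (EndsWithDown-tail false P ends))
≼⇒≤D-fuel (suc n) d u (true ∷ P)  (false ∷ Q) _         le       _ _      _    = ⊥-elim (codeFrom-suc-≰ d _ Q le)
≼⇒≤D-fuel (suc n) d u (false ∷ P) (true ∷ Q)  (s≤s len) le       r downs≡ ends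
  with downs-ups-down P ups>0 (EndsWithDown-tail false P ends)
  where
  ups>0 : 0 < ups P
  ups>0 = subst (0 <_) (sym (trans (sym (length-codeFrom (suc d) P)) (Pointwise.Pointwise-length le))) (s≤s z≤n)
... | e , k , b , refl = ≼⇒≤D-down-up n (≼⇒≤D-fuel n) d u e k b Q len le r downs≡ ends

≼⇒≤D : ∀ P Q → code P ≼ code Q → downs P ≡ downs Q → EndsWithDown P → P ≤D Q
≼⇒≤D P Q (le , r) = ≼⇒≤D-fuel (length P) 0 false P Q ≤-refl le r

decodeFrom-EndsWithDown : ∀ N d l → SortedBelow N d l → EndsWithDown (decodeFrom d l N) × 0 < length (decodeFrom d l N)
decodeFrom-EndsWithDown N d []      h rewrite ∸≡suc∸suc N d h = downs-end (N ∸ suc d) , s≤s z≤n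
  where
  downs-end : ∀ j → EndsWithDown (replicate (suc j) false)
  downs-end zero    = refl
  downs-end (suc j) = downs-end j
decodeFrom-EndsWithDown N d (x ∷ l) (_ , s) with decodeFrom x l N | decodeFrom-EndsWithDown N x l s
... | c ∷ p | ends , _ =
  EndsWithDown-prefix (replicate (x ∸ d) false) true (c ∷ p) ends ,
  subst (0 <_) (sym (length-replicate-++ (x ∸ d) false (true ∷ c ∷ p))) (≤-trans (s≤s z≤n) (m≤n+m _ (x ∸ d)))

module D′Intervals (m : ℕ) (m≥1 : 1 ≤ m) where

  Admissible : ℕ → ℕ → List ℕ → Set
  Admissible k p []      = ⊤
  Admissible k p (x ∷ l) = p ≤ x × x ≤ k × m ∣ x × Admissible (suc k) x l

  D′Code : ℕ → List ℕ → Set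
  D′Code n l = length l ≡ m * n × Admissible 0 0 l

  Admissible-zeros⁻ : ∀ k s l → Admissible k 0 (replicate s 0 ++ l) → Admissible (k + s) 0 l
  Admissible-zeros⁻ k zero    l a             = subst (λ w → Admissible w 0 l) (sym (+-identityʳ k)) a
  Admissible-zeros⁻ k (suc s) l (_ , _ , _ , a) =
    subst (λ w → Admissible w 0 l) (sym (+-suc k s)) (Admissible-zeros⁻ (suc k) s l a)

  Admissible-zeros : ∀ k s l → Admissible (k + s) 0 l → Admissible k 0 (replicate s 0 ++ l)
  Admissible-zeros k zero    l a = subst (λ w → Admissible w 0 l) (+-identityʳ k) a
  Admissible-zeros k (suc s) l a =
    z≤n , z≤n , (m ∣0) , Admissible-zeros (suc k) s l (subst (λ w → Admissible w 0 l) (+-suc k s) a)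

  Admissible-weaken : ∀ k p p' l → p' ≤ p → Admissible k p l → Admissible k p' l
  Admissible-weaken k p p' []      _ _               = tt
  Admissible-weaken k p p' (x ∷ l) h (p≤x , x≤k , a) = ≤-trans h p≤x , x≤k , a

  Admissible-map-+ : ∀ k p l → Admissible k p l → Admissible (m + k) (m + p) (map (m +_) l)
  Admissible-map-+ k p []      _                       = tt
  Admissible-map-+ k p (x ∷ l) (p≤x , x≤k , m∣x , a) =
    +-monoʳ-≤ m p≤x , +-monoʳ-≤ m x≤k , ∣m∣n⇒∣m+n ∣-refl m∣x ,
    subst (λ w → Admissible w (m + x) (map (m +_) l)) (+-suc m k) (Admissible-map-+ (suc k) x l a)

  Admissible-map-∸ : ∀ k p l → Admissible (k + m) p l → Admissible k (p ∸ m) (map (_∸ m) l)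
  Admissible-map-∸ k p []      _                       = tt
  Admissible-map-∸ k p (x ∷ l) (p≤x , x≤k , m∣x , a) =
    ∸-monoˡ-≤ m p≤x , subst (x ∸ m ≤_) (m+n∸n≡m k m) (∸-monoˡ-≤ m x≤k) , ∣⇒∣∸ x m∣x ,
    Admissible-map-∸ (suc k) x l a

  Admissible-≥ : ∀ k p l → Admissible k p l → All (p ≤_) l
  Admissible-≥ k p []      _                  = []
  Admissible-≥ k p (x ∷ l) (p≤x , _ , _ , a) = p≤x ∷ All.map (≤-trans p≤x) (Admissible-≥ (suc k) x l a)

  -- Entries with index below m are multiples of m smaller than m, hence 0.
  Admissible-leadingZeros : ∀ k l → k ≤ m → Admissible k 0 l → m ∸ k ≤ length l → m ∸ k ≤ leadingZeros l
  Admissible-leadingZeros k l k≤m a h with m ≟ k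
  ... | yes refl = subst (_≤ leadingZeros l) (sym (n∸n≡0 m)) z≤n
  Admissible-leadingZeros k []      k≤m a h | no m≢k = h
  Admissible-leadingZeros k (x ∷ l) k≤m (_ , x≤k , m∣x , a) h | no m≢k
    with ∣<⇒≡0 x m∣x (≤-<-trans x≤k (≤∧≢⇒< k≤m (λ e → m≢k (sym e))))
  ... | refl = subst (_≤ suc (leadingZeros l)) (sym (+-∸-assoc 1 k<m))
                 (s≤s (Admissible-leadingZeros (suc k) l k<m a (≤-pred (subst (_≤ suc (length l)) (+-∸-assoc 1 k<m) h))))
    where
    k<m : k < m
    k<m = ≤∧≢⇒< k≤m (λ e → m≢k (sym e))

  Admissible-≥m : ∀ k p l → Admissible k p l → HeadNot 0 l → All (m ≤_) l
  Admissible-≥m k p []          _                     _ = []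
  Admissible-≥m k p (zero ∷ l)  _                     h = ⊥-elim (h refl)
  Admissible-≥m k p (suc x ∷ l) (_ , _ , m∣x , a) h = ∣⇒≤ m∣x ∷ All.map (≤-trans (∣⇒≤ m∣x)) (Admissible-≥ (suc k) (suc x) l a)

  m≤m*[1+n] : ∀ n → m ≤ m * suc n
  m≤m*[1+n] n = subst (m ≤_) (sym (*-suc m n)) (m≤m+n m (m * n))

  D′Code-leadingZeros : ∀ n l → D′Code (suc n) l → m ≤ leadingZeros l
  D′Code-leadingZeros n l (len , a) =
    Admissible-leadingZeros 0 l z≤n a (subst (m ≤_) (sym len) (m≤m*[1+n] n))

  Admissible-after-zeros : ∀ l → Admissible 0 0 l → All (m ≤_) (drop (leadingZeros l) l)
  Admissible-after-zeros l a =
    Admissible-≥m (0 + leadingZeros l) 0 (drop (leadingZeros l) l)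
      (Admissible-zeros⁻ 0 (leadingZeros l) (drop (leadingZeros l) l) (subst (Admissible 0 0) (leadingZeros-split l) a))
      (HeadNot-drop-leadingZeros l)

  Admissible-intro : ∀ N k p l → SortedUpTo N p l → UnderDiagonal k l → All (m ∣_) l → Admissible k p l
  Admissible-intro N k p []      _       _         _            = tt
  Admissible-intro N k p (x ∷ l) (p≤x , s) (x≤k , u) (m∣x ∷ ds) =
    p≤x , x≤k , m∣x , Admissible-intro N (suc k) x l s u ds

  Admissible⇒SortedBelow : ∀ N k p x l → Admissible k p (x ∷ l) → k + length (x ∷ l) ≡ N → SortedBelow N p (x ∷ l)
  Admissible⇒SortedBelow N k p x []      (p≤x , x≤k , _ , _) e = p≤x , subst (x <_) (trans (+-comm 1 k) e) (s≤s x≤k)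
  Admissible⇒SortedBelow N k p x (y ∷ l) (p≤x , _ , _ , a)   e =
    p≤x , Admissible⇒SortedBelow N (suc k) x y l a (trans (sym (+-suc k (length (y ∷ l)))) e)

  Admissible⇒UnderDiagonal : ∀ k p l → Admissible k p l → UnderDiagonal k l
  Admissible⇒UnderDiagonal k p []      _                  = tt
  Admissible⇒UnderDiagonal k p (x ∷ l) (_ , x≤k , _ , a) = x≤k , Admissible⇒UnderDiagonal (suc k) x l a

  Admissible⇒divisible : ∀ k p l → Admissible k p l → All (m ∣_) l
  Admissible⇒divisible k p []      _                  = []
  Admissible⇒divisible k p (x ∷ l) (_ , _ , m∣x , a) = m∣x ∷ Admissible⇒divisible (suc k) x l a

  D′Code⇒SortedBelow : ∀ n l → D′Code (suc n) l → SortedBelow (m * suc n) 0 l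
  D′Code⇒SortedBelow n []      (len , _) = ⊥-elim (<⇒≱ (≤-trans m≥1 (m≤m*[1+n] n)) (≤-reflexive (sym len)))
  D′Code⇒SortedBelow n (x ∷ l) (len , a) = Admissible⇒SortedBelow _ 0 0 x l a len

  code-D′Code : ∀ n P → InD' m n P → D′Code n (code P) × downs P ≡ m * n
  code-D′Code n P ((len , dyck) , desc) =
    (trans (length-codeFrom 0 P) ups≡ ,
     Admissible-intro _ 0 0 (code P) (SortedUpTo-codeFrom 0 P) (UnderDiagonal-codeFrom 0 0 P dyck)
       (codeFrom-divisible m 0 0 P z≤n (m ∣0) desc)) ,
    trans (sym balance) ups≡
    where
    balance : ups P ≡ downs P
    balance = dyckFrom-balance 0 P dyck
    ups≡ : ups P ≡ m * n
    ups≡ = double-injective (ups P) (m * n)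
             (trans (cong (ups P +_) balance)
               (trans (sym (length≡ups+downs P)) (trans len (cong (m * n +_) (+-identityʳ (m * n))))))

  decode-InD′ : ∀ n l → D′Code (suc n) l → InD' m (suc n) (decode l (m * suc n))
  decode-InD′ n l c@(len , a) =
    (trans (length-decodeFrom N 0 l sorted) (trans (cong (_+ N) len) (cong (N +_) (sym (+-identityʳ N)))) ,
     dyckFrom-decodeFrom N 0 0 l sorted (Admissible⇒UnderDiagonal 0 0 l a) z≤n len) ,
    descents-decodeFrom m N 0 l (m ∣0) sorted (Admissible⇒divisible 0 0 l a) (m∣m*n (suc n))
    where
    N = m * suc n
    sorted = SortedBelow⇒SortedUpTo N 0 l (D′Code⇒SortedBelow n l c)

  code-decode : ∀ n l → D′Code (suc n) l → code (decode l (m * suc n)) ≡ l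
  code-decode n l c = codeFrom-decodeFrom (m * suc n) 0 l (SortedBelow⇒SortedUpTo _ 0 l (D′Code⇒SortedBelow n l c))

  decode-code : ∀ n P → InD' m n P → decode (code P) (m * n) ≡ P
  decode-code n P inP =
    trans (cong (decode (code P)) (trans (sym (proj₂ (code-D′Code n P inP))) (sym (+-identityʳ (downs P)))))
          (decodeFrom-codeFrom 0 P)

  downs-decode : ∀ n l → D′Code (suc n) l → downs (decode l (m * suc n)) ≡ m * suc n
  downs-decode n l c =
    trans (sym (dyckFrom-balance 0 (decode l (m * suc n)) (proj₂ (proj₁ (decode-InD′ n l c)))))
          (trans (sym (length-codeFrom 0 (decode l (m * suc n)))) (trans (cong length (code-decode n l c)) (proj₁ c)))

  decode-≤D : ∀ n lP lQ → D′Code (suc n) lP → D′Code (suc n) lQ → lP ≼ lQ →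
              decode lP (m * suc n) ≤D decode lQ (m * suc n)
  decode-≤D n lP lQ cP cQ lP≼lQ =
    ≼⇒≤D (decode lP N) (decode lQ N) (subst₂ _≼_ (sym (code-decode n lP cP)) (sym (code-decode n lQ cQ)) lP≼lQ)
      (trans (downs-decode n lP cP) (sym (downs-decode n lQ cQ)))
      (proj₁ (decodeFrom-EndsWithDown N 0 lP (D′Code⇒SortedBelow n lP cP)))
    where
    N = m * suc n

  -- On paths, grow s prepends m up steps and inserts m down steps after the first s up steps.
  grow : ℕ → List ℕ → List ℕ
  grow s l = replicate (m + s) 0 ++ map (m +_) (drop s l)

  shrink : List ℕ → List ℕ
  shrink l = map (_∸ m) (drop m l)

  map-∸-zeros : ∀ s l → map (_∸ m) (replicate s 0 ++ l) ≡ replicate s 0 ++ map (_∸ m) l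
  map-∸-zeros zero    l = refl
  map-∸-zeros (suc s) l = cong₂ _∷_ (0∸n≡0 m) (map-∸-zeros s l)

  map-+-zeros : ∀ s l → map (m +_) (replicate s 0 ++ l) ≡ replicate s (m + 0) ++ map (m +_) l
  map-+-zeros zero    l = refl
  map-+-zeros (suc s) l = cong ((m + 0) ∷_) (map-+-zeros s l)

  map-∸-map-+ : ∀ l → map (_∸ m) (map (m +_) l) ≡ l
  map-∸-map-+ []      = refl
  map-∸-map-+ (x ∷ l) = cong₂ _∷_ (m+n∸m≡n m x) (map-∸-map-+ l)

  map-+-map-∸ : ∀ l → All (m ≤_) l → map (m +_) (map (_∸ m) l) ≡ l
  map-+-map-∸ []      _          = refl
  map-+-map-∸ (x ∷ l) (m≤x ∷ ms) = cong₂ _∷_ (m+[n∸m]≡n m≤x) (map-+-map-∸ l ms)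

  length-grow : ∀ s l → s ≤ length l → length (grow s l) ≡ m + length l
  length-grow s l h = begin
    length (replicate (m + s) 0 ++ map (m +_) (drop s l)) ≡⟨ length-replicate-++ (m + s) 0 _ ⟩
    m + s + length (map (m +_) (drop s l))
      ≡⟨ cong (m + s +_) (trans (length-map (m +_) (drop s l)) (length-drop s l)) ⟩
    m + s + (length l ∸ s)                                 ≡⟨ +-assoc m s _ ⟩
    m + (s + (length l ∸ s))                               ≡⟨ cong (m +_) (m+[n∸m]≡n h) ⟩
    m + length l                                           ∎
    where open ≡-Reasoning

  grow-D′Code : ∀ n s l → D′Code n l → s ≤ leadingZeros l → D′Code (suc n) (grow s l)
  grow-D′Code n s l (len , a) h =
    trans (length-grow s l (≤-trans h (leadingZeros≤length l))) (trans (cong (m +_) len) (sym (*-suc m n))) ,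
    Admissible-zeros 0 (m + s) _
      (Admissible-weaken (m + s) (m + 0) 0 _ z≤n
        (Admissible-map-+ s 0 (drop s l)
          (Admissible-zeros⁻ 0 s (drop s l) (subst (Admissible 0 0) (sym (leadingZeros-prefix s l h)) a))))

  shrink-D′Code : ∀ n l → D′Code (suc n) l → D′Code n (shrink l)
  shrink-D′Code n l c@(len , a) =
    trans (length-map (_∸ m) (drop m l))
      (trans (length-drop m l) (trans (cong (_∸ m) (trans len (*-suc m n))) (m+n∸m≡n m (m * n)))) ,
    subst (λ w → Admissible 0 w (shrink l)) (0∸n≡0 m)
      (Admissible-map-∸ 0 0 (drop m l)
        (Admissible-zeros⁻ 0 m (drop m l)
          (subst (Admissible 0 0) (sym (leadingZeros-prefix m l (D′Code-leadingZeros n l c))) a)))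

  shrink-grow : ∀ s l → s ≤ leadingZeros l → shrink (grow s l) ≡ l
  shrink-grow s l h = begin
    map (_∸ m) (drop m (replicate (m + s) 0 ++ map (m +_) (drop s l)))
      ≡⟨ cong (map (_∸ m)) (drop-replicate-+ m s 0 _) ⟩
    map (_∸ m) (replicate s 0 ++ map (m +_) (drop s l))
      ≡⟨ map-∸-zeros s _ ⟩
    replicate s 0 ++ map (_∸ m) (map (m +_) (drop s l))
      ≡⟨ cong (replicate s 0 ++_) (map-∸-map-+ (drop s l)) ⟩
    replicate s 0 ++ drop s l
      ≡⟨ leadingZeros-prefix s l h ⟩
    l ∎
    where open ≡-Reasoning

  grow-shrink : ∀ n l → D′Code (suc n) l → grow (leadingZeros l ∸ m) (shrink l) ≡ l
  grow-shrink n l c = subst (λ L → grow a (shrink L) ≡ L) (sym split) (cong (replicate (m + a) 0 ++_) (begin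
    map (m +_) (drop a (map (_∸ m) (drop m (replicate (m + a) 0 ++ R))))
      ≡⟨ cong (λ w → map (m +_) (drop a (map (_∸ m) w))) (drop-replicate-+ m a 0 R) ⟩
    map (m +_) (drop a (map (_∸ m) (replicate a 0 ++ R)))
      ≡⟨ cong (λ w → map (m +_) (drop a w)) (map-∸-zeros a R) ⟩
    map (m +_) (drop a (replicate a 0 ++ map (_∸ m) R))
      ≡⟨ cong (map (m +_)) (drop-replicate a 0 _) ⟩
    map (m +_) (map (_∸ m) R)
      ≡⟨ map-+-map-∸ R (Admissible-after-zeros l (proj₂ c)) ⟩
    R ∎))
    where
    open ≡-Reasoning
    a = leadingZeros l ∸ m
    R = drop (leadingZeros l) l
    split : l ≡ replicate (m + a) 0 ++ R
    split = trans (leadingZeros-split l)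
              (cong (λ w → replicate w 0 ++ R) (sym (m+[n∸m]≡n (D′Code-leadingZeros n l c))))

  leadingZeros-map-+ : ∀ l → leadingZeros (map (m +_) l) ≡ 0
  leadingZeros-map-+ []      = refl
  leadingZeros-map-+ (x ∷ l) with m + x | m≤m+n m x
  ... | zero  | m≤0 = ⊥-elim (<⇒≱ m≥1 m≤0)
  ... | suc _ | _   = refl

  leadingZeros-grow : ∀ s l → leadingZeros (grow s l) ≡ m + s
  leadingZeros-grow s l =
    trans (leadingZeros-replicate (m + s) _) (trans (cong (m + s +_) (leadingZeros-map-+ (drop s l))) (+-identityʳ _))

  leadingZeros-shrink : ∀ l → leadingZeros l ∸ m ≤ leadingZeros (shrink l)
  leadingZeros-shrink l = ≤-trans (leadingZeros-drop m l) (leadingZeros-map-∸ m (drop m l))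

  HeadNot-0-map-+ : ∀ l → HeadNot 0 (map (m +_) l)
  HeadNot-0-map-+ []      = tt
  HeadNot-0-map-+ (x ∷ l) e = <⇒≱ m≥1 (subst (m ≤_) (sym e) (m≤m+n m x))

  HeadNot-m-map-+ : ∀ l → All (m ≤_) l → HeadNot (m + 0) (map (m +_) l)
  HeadNot-m-map-+ []      _         = tt
  HeadNot-m-map-+ (x ∷ l) (m≤x ∷ _) e = <⇒≱ (≤-trans m≥1 m≤x) (subst (_≤ 0) (+-cancelˡ-≡ m 0 x e) z≤n)

  runLengths-grow-< : ∀ l s → Admissible 0 0 l → s < leadingZeros l →
    runLengths (grow s l) ≡ (m + s) ∷ (leadingZeros l ∸ s) ∷ runLengths (drop (leadingZeros l) l)
  runLengths-grow-< l s adm s<Z = begin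
    runLengths (replicate (m + s) 0 ++ map (m +_) (drop s l))
      ≡⟨ cong (λ w → runLengths (replicate (m + s) 0 ++ map (m +_) w)) drop-s ⟩
    runLengths (replicate (m + s) 0 ++ map (m +_) (replicate a 0 ++ R))
      ≡⟨ cong (λ w → runLengths (replicate (m + s) 0 ++ w)) (map-+-zeros a R) ⟩
    runLengths (replicate (m + s) 0 ++ replicate a (m + 0) ++ map (m +_) R)
      ≡⟨ runLengths-replicate (m + s) 0 _ (≤-trans m≥1 (m≤m+n m s)) head-not-0 ⟩
    (m + s) ∷ runLengths (replicate a (m + 0) ++ map (m +_) R)
      ≡⟨ cong ((m + s) ∷_) (runLengths-replicate a (m + 0) _ a≥1 (HeadNot-m-map-+ R (Admissible-after-zeros l adm))) ⟩
    (m + s) ∷ a ∷ runLengths (map (m +_) R)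
      ≡⟨ cong (λ w → (m + s) ∷ a ∷ w) (runLengths-map-+ m R) ⟩
    (m + s) ∷ a ∷ runLengths R ∎
    where
    open ≡-Reasoning
    a = leadingZeros l ∸ s
    R = drop (leadingZeros l) l
    a≥1 : 1 ≤ a
    a≥1 = m<n⇒0<n∸m s<Z
    head-not-0 : HeadNot 0 (replicate a (m + 0) ++ map (m +_) R)
    head-not-0 with a | a≥1
    ... | suc _ | _ = λ e → <⇒≱ m≥1 (subst (m ≤_) (trans (sym (+-identityʳ m)) (sym e)) ≤-refl)
    drop-s : drop s l ≡ replicate a 0 ++ R
    drop-s = trans (cong (drop s) (trans (leadingZeros-split l)
                                         (cong (λ w → replicate w 0 ++ R) (sym (m+[n∸m]≡n (<⇒≤ s<Z))))))
                   (drop-replicate-+ s a 0 R)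

  runLengths-grow-≡ : ∀ l →
    runLengths (grow (leadingZeros l) l) ≡ (m + leadingZeros l) ∷ runLengths (drop (leadingZeros l) l)
  runLengths-grow-≡ l = begin
    runLengths (replicate (m + Z) 0 ++ map (m +_) (drop Z l))
      ≡⟨ runLengths-replicate (m + Z) 0 _ (≤-trans m≥1 (m≤m+n m Z)) (HeadNot-0-map-+ (drop Z l)) ⟩
    (m + Z) ∷ runLengths (map (m +_) (drop Z l))
      ≡⟨ cong ((m + Z) ∷_) (runLengths-map-+ m (drop Z l)) ⟩
    (m + Z) ∷ runLengths (drop Z l) ∎
    where
    open ≡-Reasoning
    Z = leadingZeros l

  CodeInterval : ℕ → List ℕ × List ℕ → Set
  CodeInterval n (lP , lQ) = D′Code n lP × D′Code n lQ × lP ≼ lQ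

  -- The leading zeros of a code count the first ascent of its path and its run lengths are the ascent
  -- lengths, so the label is (first ascent of P − m , r(P,Q) − 1).
  label : List ℕ × List ℕ → ℕ × ℕ
  label (lP , lQ) = leadingZeros lP ∸ m , runsWithin (runLengths lP) (leadingZeros lQ) ∸ 1

  -- The first ascent of the grown Q covers exactly the first j + 1 ascents of the grown P.
  growInterval : List ℕ × List ℕ → ℕ × ℕ → List ℕ × List ℕ
  growInterval (lP , lQ) (i , j) = grow i lP , grow (sum (take (suc j) (runLengths (grow i lP))) ∸ m) lQ

  shrinkInterval : List ℕ × List ℕ → List ℕ × List ℕ
  shrinkInterval (lP , lQ) = shrink lP , shrink lQ

  -- (i′ − i , j′ − j) is a step of S′_m.
  Step : ℕ × ℕ → ℕ × ℕ → Set
  Step (i , j) (i′ , j′) = (i′ < i + m × j′ ≤ suc j) ⊎ (i′ ≡ i + m × j′ ≤ j)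

  r-statistic : ∀ n lP lQ → CodeInterval (suc n) (lP , lQ) →
    let r = runsWithin (runLengths lP) (leadingZeros lQ) in
    1 ≤ r × r ≤ length (runLengths lP) × sum (take r (runLengths lP)) ≡ leadingZeros lQ
  r-statistic n lP lQ (cP , _ , lP≼lQ@(le , _)) =
    subst (1 ≤_) (sym r≡) (runLengths-nonempty zQ lP zQ≥1 zQ≤) , subst (_≤ length (runLengths lP)) (sym r≡) r≤ ,
    trans (cong (λ r → sum (take r (runLengths lP))) r≡) sum≡
    where
    zQ = leadingZeros lQ
    r₀ = length (runLengths (take zQ lP))
    zQ≤ : zQ ≤ length lP
    zQ≤ = subst (zQ ≤_) (sym (Pointwise.Pointwise-length le)) (leadingZeros≤length lQ)
    zQ≥1 : 1 ≤ zQ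
    zQ≥1 = ≤-trans m≥1 (≤-trans (D′Code-leadingZeros n lP cP) (leadingZeros-mono lP lQ le))
    boundary : r₀ ≤ length (runLengths lP) × sum (take r₀ (runLengths lP)) ≡ zQ × runsWithin (runLengths lP) zQ ≡ r₀
    boundary = runsWithin-at-boundary zQ lP zQ≤ (≼-separates-leadingZeros lP lQ lP≼lQ)
    r≤  = proj₁ boundary
    sum≡ = proj₁ (proj₂ boundary)
    r≡  = proj₂ (proj₂ boundary)

  CodeInterval-shape : ∀ n lP lQ → CodeInterval (suc n) (lP , lQ) →
    let Z = leadingZeros lP ; Rs = runLengths (drop Z lP) ; j = proj₂ (label (lP , lQ)) in
    m ≤ Z × runLengths lP ≡ Z ∷ Rs × j ≤ length Rs × leadingZeros lQ ≡ Z + sum (take j Rs)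
  CodeInterval-shape n lP lQ I@(cP , _ , _) = m≤Z , runs , j≤ , zQ≡
    where
    Z = leadingZeros lP
    Rs = runLengths (drop Z lP)
    r = runsWithin (runLengths lP) (leadingZeros lQ)
    m≤Z : m ≤ Z
    m≤Z = D′Code-leadingZeros n lP cP
    runs : runLengths lP ≡ Z ∷ Rs
    runs = runLengths-leadingZeros lP (≤-trans m≥1 m≤Z)
    stat = r-statistic n lP lQ I
    r≡ : r ≡ suc (r ∸ 1)
    r≡ = sym (m+[n∸m]≡n (proj₁ stat))
    j≤ : r ∸ 1 ≤ length Rs
    j≤ = ≤-pred (subst₂ _≤_ r≡ (cong length runs) (proj₁ (proj₂ stat)))
    zQ≡ : leadingZeros lQ ≡ Z + sum (take (r ∸ 1) Rs)
    zQ≡ = trans (sym (proj₂ (proj₂ stat)))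
            (trans (cong (λ w → sum (take w (runLengths lP))) r≡) (cong (λ w → sum (take (suc (r ∸ 1)) w)) runs))

  -- The new first ascent of Q ends at a run boundary of the grown P, so the two pieces do not interact.
  grow-≼ : ∀ lP lQ s p k → lP ≼ lQ → s ≤ leadingZeros lP → s ≤ p → p ≤ length lP →
           m + p ≡ sum (take k (runLengths (grow s lP))) → k ≤ length (runLengths (grow s lP)) →
           grow s lP ≼ grow p lQ
  grow-≼ lP lQ s p k lP≼lQ s≤Z s≤p p≤ e k≤ =
    subst (_≼ grow p lQ) (take++drop≡id (m + p) lP′) (dominates , refines)
    where
    lP′ = grow s lP
    A = take (m + p) lP′
    B = drop (m + p) lP′
    sep : Separated A B
    sep = subst (λ w → Separated (take w lP′) (drop w lP′)) (sym e) (separated-at-runs k lP′ k≤)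
    B≡ : B ≡ map (m +_) (drop p lP)
    B≡ = begin
      drop (m + p) lP′                             ≡⟨ cong (λ w → drop (m + w) lP′) (sym (m+[n∸m]≡n s≤p)) ⟩
      drop (m + (s + (p ∸ s))) lP′                 ≡⟨ cong (λ w → drop w lP′) (sym (+-assoc m s (p ∸ s))) ⟩
      drop ((m + s) + (p ∸ s)) lP′                 ≡⟨ drop-replicate-++ (m + s) (p ∸ s) 0 _ ⟩
      drop (p ∸ s) (map (m +_) (drop s lP))        ≡⟨ drop-map (p ∸ s) (drop s lP) ⟩
      map (m +_) (drop (p ∸ s) (drop s lP))        ≡⟨ cong (map (m +_)) (drop-drop s (p ∸ s) lP) ⟩
      map (m +_) (drop (s + (p ∸ s)) lP)           ≡⟨ cong (λ w → map (m +_) (drop w lP)) (m+[n∸m]≡n s≤p) ⟩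
      map (m +_) (drop p lP)                       ∎
      where open ≡-Reasoning
    lengthA : length A ≡ m + p
    lengthA = length-take-≤ (m + p) lP′
                (subst (m + p ≤_) (sym (length-grow s lP (≤-trans s≤Z (leadingZeros≤length lP)))) (+-monoʳ-≤ m p≤))
    rest : drop p lP ≼ drop p lQ
    rest = ≼-drop p lP lQ lP≼lQ
    dominates : Pointwise _≥_ (A ++ B) (replicate (m + p) 0 ++ map (m +_) (drop p lQ))
    dominates = Pointwise.++⁺ (subst (λ w → Pointwise _≥_ A (replicate w 0)) lengthA (≥-replicate-0 A))
           (subst (λ w → Pointwise _≥_ w _) (sym B≡) (Pointwise.map⁺ _ _ (Pointwise.map (+-monoʳ-≤ m) (proj₁ rest))))
    refines : RunsRefine (A ++ B) (replicate (m + p) 0 ++ map (m +_) (drop p lQ))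
    refines = RunsRefine-++ A B (replicate (m + p) 0) _ (trans lengthA (sym (length-replicate (m + p))))
          (RunsRefine-replicateʳ A (m + p) 0) (subst (λ w → RunsRefine w _) (sym B≡) (RunsRefine-map-+ m _ _ (proj₂ rest)))
          (λ g → ⊥-elim (Separated⇒¬Glued A B sep g))

  GrowthOf : ℕ → List ℕ × List ℕ → ℕ × ℕ → List ℕ × List ℕ → Set
  GrowthOf n J ℓ J′ = CodeInterval (suc n) J′ × shrinkInterval J′ ≡ J × label J′ ≡ ℓ

  growInterval-GrowthOf : ∀ n lP lQ s p k → CodeInterval (suc n) (lP , lQ) →
    s ≤ leadingZeros lP → s ≤ p → p ≤ leadingZeros lQ →
    m + p ≡ sum (take (suc k) (runLengths (grow s lP))) → suc k ≤ length (runLengths (grow s lP)) →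
    GrowthOf (suc n) (lP , lQ) (s , k) (growInterval (lP , lQ) (s , k))
  growInterval-GrowthOf n lP lQ s p k (cP , cQ , lP≼lQ) s≤Z s≤p p≤zQ e k< =
    subst (GrowthOf (suc n) (lP , lQ) (s , k)) (cong (λ q → grow s lP , grow q lQ) (sym p≡))
      ((grow-D′Code (suc n) s lP cP s≤Z , grow-D′Code (suc n) p lQ cQ p≤zQ ,
        grow-≼ lP lQ s p (suc k) lP≼lQ s≤Z s≤p p≤ e k<) ,
       cong₂ _,_ (shrink-grow s lP s≤Z) (shrink-grow p lQ p≤zQ) ,
       cong₂ _,_ (trans (cong (_∸ m) (leadingZeros-grow s lP)) (m+n∸m≡n m s))
                 (cong (_∸ 1) (trans (cong (runsWithin (runLengths (grow s lP))) (trans (leadingZeros-grow p lQ) e))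
                                     (runsWithin-sum-take (runLengths (grow s lP)) (suc k) (runLengths-positive (grow s lP)) k<))))
    where
    p≡ : sum (take (suc k) (runLengths (grow s lP))) ∸ m ≡ p
    p≡ = trans (cong (_∸ m) (sym e)) (m+n∸m≡n m p)
    p≤ : p ≤ length lP
    p≤ = ≤-trans p≤zQ
           (subst (leadingZeros lQ ≤_) (sym (Pointwise.Pointwise-length (proj₁ lP≼lQ))) (leadingZeros≤length lQ))

  growInterval-correct : ∀ n J ℓ → CodeInterval (suc n) J → Step (label J) ℓ →
                         GrowthOf (suc n) J ℓ (growInterval J ℓ)
  growInterval-correct n (lP , lQ) (i′ , j′) I step = go i′ j′ step
    where
    Z  = leadingZeros lP
    Rs = runLengths (drop Z lP)
    j  = proj₂ (label (lP , lQ))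
    shape = CodeInterval-shape n lP lQ I
    m≤Z : m ≤ Z
    m≤Z = proj₁ shape
    j≤ : j ≤ length Rs
    j≤ = proj₁ (proj₂ (proj₂ shape))
    zQ≡ : leadingZeros lQ ≡ Z + sum (take j Rs)
    zQ≡ = proj₂ (proj₂ (proj₂ shape))
    below-zQ : ∀ t → t ≤ j → Z + sum (take t Rs) ≤ leadingZeros lQ
    below-zQ t t≤j = subst (Z + sum (take t Rs) ≤_) (sym zQ≡) (+-monoʳ-≤ Z (sum-take-mono Rs t j t≤j))
    go : ∀ i′ j′ → Step (label (lP , lQ)) (i′ , j′) →
         GrowthOf (suc n) (lP , lQ) (i′ , j′) (growInterval (lP , lQ) (i′ , j′))
    go i′ zero (inj₁ (i′<i+m , _)) =
      growInterval-GrowthOf n lP lQ i′ i′ 0 I (<⇒≤ i′<Z) ≤-refl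
        (≤-trans (<⇒≤ i′<Z) (≤-trans (m≤m+n Z 0) (below-zQ 0 z≤n)))
        (trans (sym (+-identityʳ (m + i′))) (cong (λ w → sum (take 1 w)) (sym runs′)))
        (subst (λ w → 1 ≤ length w) (sym runs′) (s≤s z≤n))
      where
      i′<Z : i′ < Z
      i′<Z = subst (i′ <_) (m∸n+n≡m m≤Z) i′<i+m
      runs′ = runLengths-grow-< lP i′ (proj₂ (proj₁ I)) i′<Z
    go i′ (suc t) (inj₁ (i′<i+m , s≤s t≤j)) =
      growInterval-GrowthOf n lP lQ i′ (Z + sum (take t Rs)) (suc t) I (<⇒≤ i′<Z) (≤-trans (<⇒≤ i′<Z) (m≤m+n Z _))
        (below-zQ t t≤j) (trans e (cong (λ w → sum (take (suc (suc t)) w)) (sym runs′)))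
        (subst (λ w → suc (suc t) ≤ length w) (sym runs′) (s≤s (s≤s (≤-trans t≤j j≤))))
      where
      i′<Z : i′ < Z
      i′<Z = subst (i′ <_) (m∸n+n≡m m≤Z) i′<i+m
      runs′ = runLengths-grow-< lP i′ (proj₂ (proj₁ I)) i′<Z
      e : m + (Z + sum (take t Rs)) ≡ (m + i′) + ((Z ∸ i′) + sum (take t Rs))
      e = trans (cong (m +_) (sym (m+[[n∸m]+o]≡n+o i′ Z _ (<⇒≤ i′<Z)))) (sym (+-assoc m i′ _))
    go i′ j′ (inj₂ (i′≡i+m , j′≤j)) =
      subst (λ s → GrowthOf (suc n) (lP , lQ) (s , j′) (growInterval (lP , lQ) (s , j′)))
        (sym (trans i′≡i+m (m∸n+n≡m m≤Z)))
        (growInterval-GrowthOf n lP lQ Z (Z + sum (take j′ Rs)) j′ I ≤-refl (m≤m+n Z _) (below-zQ j′ j′≤j)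
          (trans (sym (+-assoc m Z _)) (cong (λ w → sum (take (suc j′) w)) (sym (runLengths-grow-≡ lP))))
          (subst (λ w → suc j′ ≤ length w) (sym (runLengths-grow-≡ lP)) (s≤s (≤-trans j′≤j j≤))))

  shrinkInterval-CodeInterval : ∀ n J → CodeInterval (suc (suc n)) J → CodeInterval (suc n) (shrinkInterval J)
  shrinkInterval-CodeInterval n (lP , lQ) (cP , cQ , lP≼lQ) =
    shrink-D′Code (suc n) lP cP , shrink-D′Code (suc n) lQ cQ , ≼-map-∸ m _ _ (≼-drop m lP lQ lP≼lQ)

  growInterval-shrinkInterval : ∀ n J → CodeInterval (suc (suc n)) J → growInterval (shrinkInterval J) (label J) ≡ J
  growInterval-shrinkInterval n (lP , lQ) I@(cP , cQ , _) = cong₂ _,_ regrowP (begin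
    grow (sum (take (suc (r ∸ 1)) (runLengths (grow i (shrink lP)))) ∸ m) (shrink lQ)
      ≡⟨ cong (λ w → grow (sum (take (suc (r ∸ 1)) (runLengths w)) ∸ m) (shrink lQ)) regrowP ⟩
    grow (sum (take (suc (r ∸ 1)) (runLengths lP)) ∸ m) (shrink lQ)
      ≡⟨ cong (λ w → grow (sum (take w (runLengths lP)) ∸ m) (shrink lQ)) (m+[n∸m]≡n (proj₁ stat)) ⟩
    grow (sum (take r (runLengths lP)) ∸ m) (shrink lQ)
      ≡⟨ cong (λ w → grow (w ∸ m) (shrink lQ)) (proj₂ (proj₂ stat)) ⟩
    grow (leadingZeros lQ ∸ m) (shrink lQ)
      ≡⟨ grow-shrink (suc n) lQ cQ ⟩
    lQ ∎)
    where
    open ≡-Reasoning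
    i = leadingZeros lP ∸ m
    r = runsWithin (runLengths lP) (leadingZeros lQ)
    stat = r-statistic (suc n) lP lQ I
    regrowP : grow i (shrink lP) ≡ lP
    regrowP = grow-shrink (suc n) lP cP

  shrinkInterval-Step : ∀ n J → CodeInterval (suc (suc n)) J → Step (label (shrinkInterval J)) (label J)
  shrinkInterval-Step n (lP , lQ) I@(cP , _ , lP≼lQ) = [ below , at ]′ (m≤n⇒m<n∨m≡n (leadingZeros-shrink lP))
    where
    Z  = leadingZeros (shrink lP)
    Rs = runLengths (drop Z (shrink lP))
    j  = proj₂ (label (shrink lP , shrink lQ))
    i  = leadingZeros lP ∸ m
    r  = runsWithin (runLengths lP) (leadingZeros lQ)
    p  = leadingZeros lQ ∸ m
    I′ = shrinkInterval-CodeInterval n (lP , lQ) I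
    shape = CodeInterval-shape n (shrink lP) (shrink lQ) I′
    stat  = r-statistic (suc n) lP lQ I
    m≤Z : m ≤ Z
    m≤Z = proj₁ shape
    m+p≡ : m + p ≡ leadingZeros lQ
    m+p≡ = m+[n∸m]≡n (≤-trans (D′Code-leadingZeros (suc n) lP cP) (leadingZeros-mono lP lQ (proj₁ lP≼lQ)))
    regrowP : grow i (shrink lP) ≡ lP
    regrowP = grow-shrink (suc n) lP cP
    bounded : ∀ t → Z + sum (take t Rs) ≡ p → t ≤ length Rs → t ≤ j
    bounded t e t≤ = sum-take-mono⁻ Rs t j (runLengths-positive (drop Z (shrink lP))) t≤
      (+-cancelˡ-≤ Z _ _ (subst₂ _≤_ (sym e) (proj₂ (proj₂ (proj₂ shape))) (leadingZeros-shrink lQ)))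
    First : List ℕ → Set
    First runs = ∀ r → 1 ≤ r → r ≤ length runs → sum (take r runs) ≡ leadingZeros lQ →
                 Step (Z ∸ m , j) (i , r ∸ 1)
    use : ∀ runs → runLengths lP ≡ runs → First runs → Step (Z ∸ m , j) (i , r ∸ 1)
    use runs eq step = step r (proj₁ stat) (subst (λ w → r ≤ length w) eq (proj₁ (proj₂ stat)))
                                           (subst (λ w → sum (take r w) ≡ leadingZeros lQ) eq (proj₂ (proj₂ stat)))
    below : i < Z → Step (Z ∸ m , j) (i , r ∸ 1)
    below i<Z = use _ (trans (cong runLengths (sym regrowP)) (runLengths-grow-< (shrink lP) i (proj₂ (proj₁ I′)) i<Z)) go
      where
      i<Z′ : i < Z ∸ m + m
      i<Z′ = subst (i <_) (sym (m∸n+n≡m m≤Z)) i<Z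
      go : First ((m + i) ∷ (Z ∸ i) ∷ Rs)
      go (suc zero)    _ _                 _ = inj₁ (i<Z′ , z≤n)
      go (suc (suc t)) _ (s≤s (s≤s t≤)) e = inj₁ (i<Z′ , s≤s (bounded t (+-cancelˡ-≡ m _ _ (begin
        m + (Z + sum (take t Rs))                 ≡⟨ cong (m +_) (sym (m+[[n∸m]+o]≡n+o i Z _ (<⇒≤ i<Z))) ⟩
        m + (i + ((Z ∸ i) + sum (take t Rs)))     ≡⟨ sym (+-assoc m i _) ⟩
        (m + i) + ((Z ∸ i) + sum (take t Rs))     ≡⟨ e ⟩
        leadingZeros lQ                           ≡⟨ sym m+p≡ ⟩
        m + p                                     ∎)) t≤))
        where open ≡-Reasoning
    at : i ≡ Z → Step (Z ∸ m , j) (i , r ∸ 1)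
    at i≡Z = use _ (trans (cong runLengths (trans (sym regrowP) (cong (λ w → grow w (shrink lP)) i≡Z)))
                          (runLengths-grow-≡ (shrink lP))) go
      where
      go : First ((m + Z) ∷ Rs)
      go (suc t) _ (s≤s t≤) e =
        inj₂ (trans i≡Z (sym (m∸n+n≡m m≤Z)) ,
              bounded t (+-cancelˡ-≡ m _ _ (trans (sym (+-assoc m Z _)) (trans e (sym m+p≡)))) t≤)

  baseInterval : List ℕ × List ℕ
  baseInterval = replicate m 0 , replicate m 0

  D′Code-one : ∀ l → D′Code 1 l → l ≡ replicate m 0
  D′Code-one l c@(len , _) = begin
    l                         ≡⟨ sym (leadingZeros-prefix m l (D′Code-leadingZeros 0 l c)) ⟩
    replicate m 0 ++ drop m l ≡⟨ cong (replicate m 0 ++_) (drop-all m l (≤-reflexive (trans len (*-identityʳ m)))) ⟩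
    replicate m 0 ++ []       ≡⟨ ++-identityʳ _ ⟩
    replicate m 0             ∎
    where open ≡-Reasoning

  CodeInterval-one : ∀ J → CodeInterval 1 J → J ≡ baseInterval
  CodeInterval-one (lP , lQ) (cP , cQ , _) = cong₂ _,_ (D′Code-one lP cP) (D′Code-one lQ cQ)

  baseInterval-CodeInterval : CodeInterval 1 baseInterval
  baseInterval-CodeInterval = base , base , ≼-refl (replicate m 0)
    where
    base : D′Code 1 (replicate m 0)
    base = trans (length-replicate m) (sym (*-identityʳ m)) ,
           subst (Admissible 0 0) (++-identityʳ (replicate m 0)) (Admissible-zeros 0 m [] tt)

  label-baseInterval : label baseInterval ≡ (0 , 0)
  label-baseInterval = cong₂ _,_ (trans (cong (_∸ m) zeros) (n∸n≡0 m))
    (cong (_∸ 1) (trans (cong₂ runsWithin runs (trans zeros (sym (+-identityʳ m))))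
                        (runsWithin-sum-take (m ∷ []) 1 (m≥1 ∷ []) (s≤s z≤n))))
    where
    zeros : leadingZeros (replicate m 0) ≡ m
    zeros = trans (cong leadingZeros (sym (++-identityʳ (replicate m 0)))) (trans (leadingZeros-replicate m []) (+-identityʳ m))
    runs : runLengths (replicate m 0) ≡ m ∷ []
    runs = trans (cong runLengths (sym (++-identityʳ (replicate m 0)))) (runLengths-replicate m 0 [] m≥1 tt)

  ≤D⇒CodeInterval : ∀ n P Q → InD' m n P → InD' m n Q → P ≤D Q → CodeInterval n (code P , code Q)
  ≤D⇒CodeInterval n P Q inP inQ P≤Q =
    proj₁ (code-D′Code n P inP) , proj₁ (code-D′Code n Q inQ) , ≤D⇒≼ P Q P≤Q

  ascents≡runLengths-code : ∀ n P → InD' m (suc n) P → ascents P ≡ runLengths (code P)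
  ascents≡runLengths-code n P inP =
    trans (cong ascents (sym (decode-code (suc n) P inP)))
          (ascents-decode _ (code P) (D′Code⇒SortedBelow n (code P) (proj₁ (code-D′Code (suc n) P inP))))

  firstAscent≡leadingZeros-code : ∀ n P → InD' m (suc n) P →
                                  m ≤ leadingZeros (code P) × firstAscent P ≡ leadingZeros (code P)
  firstAscent≡leadingZeros-code n P inP =
    m≤Z , trans (cong headOr0 (ascents≡runLengths-code n P inP))
                (cong headOr0 (runLengths-leadingZeros (code P) (≤-trans m≥1 m≤Z)))
    where
    m≤Z : m ≤ leadingZeros (code P)
    m≤Z = D′Code-leadingZeros n (code P) (proj₁ (code-D′Code (suc n) P inP))

  firstAscent-label : ∀ n P Q → InD' m (suc n) P → firstAscent P ≡ m + proj₁ (label (code P , code Q))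
  firstAscent-label n P Q inP = trans (proj₂ fa) (sym (m+[n∸m]≡n (proj₁ fa)))
    where
    fa = firstAscent≡leadingZeros-code n P inP

  IsR-label : ∀ n P Q → InD' m (suc n) P → InD' m (suc n) Q → P ≤D Q → IsR P Q (1 + proj₂ (label (code P , code Q)))
  IsR-label n P Q inP inQ P≤Q =
    subst (IsR P Q) (sym (m+[n∸m]≡n (proj₁ stat)))
      (subst (λ A → r ≤ length A × sum (take r A) ≡ firstAscent Q) (sym (ascents≡runLengths-code n P inP))
        (proj₁ (proj₂ stat) , trans (proj₂ (proj₂ stat)) (sym (proj₂ (firstAscent≡leadingZeros-code n Q inQ)))))
    where
    r = runsWithin (runLengths (code P)) (leadingZeros (code Q))
    stat = r-statistic n (code P) (code Q) (≤D⇒CodeInterval (suc n) P Q inP inQ P≤Q)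

-- Imported only here: with +_ in scope, sections such as (m +_) above would be ambiguous.
open import Data.Integer using (+_)

point : ℕ × ℕ → Pt
point (i , j) = (+ i , + j)

stepBetween : ℕ × ℕ → ℕ × ℕ → Pt
stepBetween (i , j) (i′ , j′) = (i′ ⊖ i , j′ ⊖ j)

move : ℕ × ℕ → Pt → ℕ × ℕ
move (i , j) (a , b) = (∣ + i ℤ.+ a ∣ , ∣ + j ℤ.+ b ∣)

All-points-start : ∀ {P : Pt → Set} p S → All P (points p S) → P p
All-points-start p []      (q ∷ _) = q
All-points-start p (_ ∷ S) (q ∷ _) = q

⊖≡+ : ∀ a b k → a ≡ b + k → a ⊖ b ≡ + k
⊖≡+ .(b + k) b k refl = trans (ℤ.⊖-≥ (m≤m+n b k)) (cong +_ (m+n∸m≡n b k))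

⊖≡+⁻ : ∀ a b k → a ⊖ b ≡ + k → a ≡ b + k
⊖≡+⁻ a b k e = ℤ.+-injective (begin
  + a                   ≡⟨ sym (sub-add (+ a) (+ b)) ⟩
  (+ a ℤ.- + b) ℤ.+ + b ≡⟨ cong (ℤ._+ + b) (trans (ℤ.[+m]-[+n]≡m⊖n a b) e) ⟩
  + (k + b)             ≡⟨ cong +_ (+-comm k b) ⟩
  + (b + k)             ∎)
  where
  open ≡-Reasoning
  sub-add : ∀ (x y : ℤ) → (x ℤ.- y) ℤ.+ y ≡ x
  sub-add = solve-∀

⊖≤+ : ∀ a b k → a ≤ b + k → a ⊖ b ℤ.≤ + k
⊖≤+ a b k h = ℤ.≤-trans (ℤ.⊖-monoˡ-≤ b h) (ℤ.≤-reflexive (⊖≡+ (b + k) b k refl))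

⊖≤+⁻ : ∀ a b k → a ⊖ b ℤ.≤ + k → a ≤ b + k
⊖≤+⁻ a b k h with a ≤? b + k
... | yes a≤ = a≤
... | no a≰  = ⊥-elim (1+n≰n (ℤ.drop‿+≤+ (begin
  + suc k           ≡⟨ sym (⊖≡+ (suc (b + k)) b (suc k) (sym (+-suc b k))) ⟩
  suc (b + k) ⊖ b   ≤⟨ ℤ.⊖-monoˡ-≤ b (≰⇒> a≰) ⟩
  a ⊖ b             ≤⟨ h ⟩
  + k               ∎)))
  where open ℤ.≤-Reasoning

+m-+1 : ∀ {m} → 1 ≤ m → + m ℤ.- + 1 ≡ + (m ∸ 1)
+m-+1 {m} m≥1 = trans (ℤ.[+m]-[+n]≡m⊖n m 1) (⊖≡+ m 1 (m ∸ 1) (sym (m+[n∸m]≡n m≥1)))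

+-cancelˡ-ℤ : ∀ (x s t : ℤ) → x ℤ.+ s ≡ x ℤ.+ t → s ≡ t
+-cancelˡ-ℤ x s t e = trans (regroup x s) (trans (cong (λ w → ℤ.- x ℤ.+ w) e) (sym (regroup x t)))
  where
  regroup : ∀ (x s : ℤ) → s ≡ ℤ.- x ℤ.+ (x ℤ.+ s)
  regroup = solve-∀

⊕-cancelˡ : ∀ p s t → p ⊕ s ≡ p ⊕ t → s ≡ t
⊕-cancelˡ (a , b) (s , s′) (t , t′) e =
  cong₂ _,_ (+-cancelˡ-ℤ a s t (cong proj₁ e)) (+-cancelˡ-ℤ b s′ t′ (cong proj₂ e))

point-stepBetween : ∀ ℓ ℓ′ → point ℓ ⊕ stepBetween ℓ ℓ′ ≡ point ℓ′
point-stepBetween (i , j) (i′ , j′) = cong₂ _,_ (shift i i′) (shift j j′)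
  where
  shift : ∀ i i′ → + i ℤ.+ (i′ ⊖ i) ≡ + i′
  shift i i′ = trans (ℤ.distribʳ-⊖-+-pos i i′ i) (⊖≡+ (i + i′) i i′ refl)

move-stepBetween : ∀ ℓ ℓ′ → move ℓ (stepBetween ℓ ℓ′) ≡ ℓ′
move-stepBetween ℓ ℓ′ = cong (λ { (a , b) → ∣ a ∣ , ∣ b ∣ }) (point-stepBetween ℓ ℓ′)

point-move : ∀ ℓ s → InN2 (point ℓ ⊕ s) → point (move ℓ s) ≡ point ℓ ⊕ s
point-move (i , j) (a , b) (0≤a , 0≤b) = cong₂ _,_ (ℤ.0≤i⇒+∣i∣≡i 0≤a) (ℤ.0≤i⇒+∣i∣≡i 0≤b)

stepBetween-move : ∀ ℓ s → InN2 (point ℓ ⊕ s) → stepBetween ℓ (move ℓ s) ≡ s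
stepBetween-move ℓ s inN2 =
  ⊕-cancelˡ (point ℓ) _ s (trans (point-stepBetween ℓ (move ℓ s)) (point-move ℓ s inN2))

Pt-≟ : (p q : Pt) → Dec (p ≡ q)
Pt-≟ = Product.≡-dec ℤ._≟_ ℤ._≟_

IsR? : ∀ P Q r → Dec (IsR P Q r)
IsR? P Q r = (r ≤? length (ascents P)) ×-dec (sum (take r (ascents P)) ≟ firstAscent Q)

walk-ext : ∀ {m ℓ} {w w′ : Walk m ℓ} → steps w ≡ steps w′ → w ≡ w′
walk-ext {w = walk s _ _ _} {walk .s _ _ _} refl = refl

interval-ext : ∀ {m n} {I I′ : Interval m n} → bot I ≡ bot I′ → top I ≡ top I′ → I ≡ I′
interval-ext {I = interval b t _ _ _} {interval .b .t _ _ _} refl refl = refl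

excursion-ext : ∀ {m ℓ} {e e′ : Excursion m ℓ} → Excursion.path e ≡ Excursion.path e′ → e ≡ e′
excursion-ext {e = excursion p _} {excursion .p _} refl = refl

negate : Pt → Pt
negate (a , b) = (ℤ.- a , ℤ.- b)

⊕-negate : ∀ p → p ⊕ negate p ≡ origin
⊕-negate (a , b) = cong₂ _,_ (ℤ.+-inverseʳ a) (ℤ.+-inverseʳ b)

endpoint-snoc : ∀ s S t → endpoint s (S ++ t ∷ []) ≡ endpoint s S ⊕ t
endpoint-snoc s []      t = refl
endpoint-snoc s (x ∷ S) t = endpoint-snoc (s ⊕ x) S t

points-snoc : ∀ s S t → points s (S ++ t ∷ []) ≡ points s S ++ (endpoint s S ⊕ t) ∷ []
points-snoc s []      t = refl
points-snoc s (x ∷ S) t = cong (s ∷_) (points-snoc (s ⊕ x) S t)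

All-points-end : ∀ {P : Pt → Set} s S → All P (points s S) → P (endpoint s S)
All-points-end s []      (q ∷ _)  = q
All-points-end s (x ∷ S) (_ ∷ qs) = All-points-end (s ⊕ x) S qs

points-take : ∀ s k S → points s (take k S) ≡ take (suc k) (points s S)
points-take s zero    []      = refl
points-take s zero    (_ ∷ _) = refl
points-take s (suc k) []      = refl
points-take s (suc k) (x ∷ S) = cong (s ∷_) (points-take (s ⊕ x) k S)

negate-InS′ : ∀ {m} → 1 ≤ m → ∀ p → InN2 p → InS' m (negate p)
negate-InS′ m≥1 (a , b) (0≤a , 0≤b) =
  inj₂ (subst (ℤ.- a ℤ.≤_) (sym (+m-+1 m≥1)) (≤-non-neg 0≤a) , ≤-non-neg 0≤b)
  where
  ≤-non-neg : ∀ {a k} → 0ℤ ℤ.≤ a → ℤ.- a ℤ.≤ + k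
  ≤-non-neg 0≤a = ℤ.≤-trans (ℤ.neg-mono-≤ 0≤a) (+≤+ z≤n)

module _ (m : ℕ) (m≥1 : 1 ≤ m) (ℓ : ℕ) where

  closeWalk : Walk m ℓ → Excursion m (suc ℓ)
  closeWalk (walk S len S∈S′ inN2) = excursion
    (walk (S ++ negate (endpoint origin S) ∷ [])
      (trans (length-++ S) (trans (+-comm (length S) 1) (cong suc len)))
      (++⁺ S∈S′ (negate-InS′ m≥1 _ (All-points-end origin S inN2) ∷ []))
      (subst (All InN2) (sym (points-snoc origin S _))
        (++⁺ inN2 (subst InN2 (sym (⊕-negate (endpoint origin S))) (+≤+ z≤n , +≤+ z≤n) ∷ []))))
    (trans (endpoint-snoc origin S _) (⊕-negate (endpoint origin S)))

  openExcursion : Excursion m (suc ℓ) → Walk m ℓ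
  openExcursion (excursion (walk T len T∈S′ inN2) _) = walk (take ℓ T)
    (trans (length-take ℓ T) (trans (cong (ℓ ⊓_) len) (m≤n⇒m⊓n≡m (n≤1+n ℓ))))
    (take⁺ ℓ T∈S′)
    (subst (All InN2) (sym (points-take origin ℓ T)) (take⁺ (suc ℓ) inN2))

  openExcursion-closeWalk : ∀ w → openExcursion (closeWalk w) ≡ w
  openExcursion-closeWalk (walk S len _ _) = walk-ext (recompute (≡-dec Pt-≟ _ _)
    (trans (cong (λ k → take k (S ++ _ ∷ [])) (sym len)) (take-length-++ S _)))

  closed-walk-split : ∀ T → length T ≡ suc ℓ → endpoint origin T ≡ origin →
                      take ℓ T ++ negate (endpoint origin (take ℓ T)) ∷ [] ≡ T
  closed-walk-split T len closed with drop ℓ T | length-drop ℓ T | take++drop≡id ℓ T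
  ... | t ∷ [] | _ | split = trans (cong (λ x → take ℓ T ++ x ∷ []) (sym last≡)) split
    where
    last≡ : t ≡ negate (endpoint origin (take ℓ T))
    last≡ = ⊕-cancelˡ (endpoint origin (take ℓ T)) t _
              (trans (sym (endpoint-snoc origin (take ℓ T) t))
                (trans (cong (endpoint origin) split) (trans closed (sym (⊕-negate (endpoint origin (take ℓ T)))))))
  ... | [] | l | _ = ⊥-elim (0≢1+n (trans l (trans (cong (_∸ ℓ) len) (m+n∸n≡m 1 ℓ))))
  ... | _ ∷ _ ∷ _ | l | _ = ⊥-elim (1+n≢0 (suc-injective (trans l (trans (cong (_∸ ℓ) len) (m+n∸n≡m 1 ℓ)))))

  closeWalk-openExcursion : ∀ e → closeWalk (openExcursion e) ≡ e
  closeWalk-openExcursion (excursion (walk T len _ _) closed) =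
    excursion-ext (walk-ext (recompute (≡-dec Pt-≟ _ _) (closed-walk-split T len closed)))

  Walk↔Excursion : Walk m ℓ ↔ Excursion m (suc ℓ)
  Walk↔Excursion = mk↔ₛ′ closeWalk openExcursion closeWalk-openExcursion openExcursion-closeWalk

module WalkBijection (m : ℕ) (m≥1 : 1 ≤ m) where
  open D′Intervals m m≥1


  +m≡suc+m∸1 : ∀ i → i + m ≡ suc (i + (m ∸ 1))
  +m≡suc+m∸1 i = trans (cong (λ k → i + k) (sym (m+[n∸m]≡n m≥1))) (+-suc i (m ∸ 1))

  Step⇒InS′ : ∀ ℓ ℓ′ → Step ℓ ℓ′ → InS' m (stepBetween ℓ ℓ′)
  Step⇒InS′ (i , j) (i′ , j′) (inj₁ (i′< , j′≤)) =
    inj₂ (subst (i′ ⊖ i ℤ.≤_) (sym (+m-+1 m≥1)) (⊖≤+ i′ i (m ∸ 1) (≤-pred (subst (suc i′ ≤_) (+m≡suc+m∸1 i) i′<))) ,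
          ⊖≤+ j′ j 1 (subst (j′ ≤_) (+-comm 1 j) j′≤))
  Step⇒InS′ (i , j) (i′ , j′) (inj₂ (i′≡ , j′≤)) =
    inj₁ (⊖≡+ i′ i m i′≡ , ⊖≤+ j′ j 0 (subst (j′ ≤_) (sym (+-identityʳ j)) j′≤))

  InS′⇒Step : ∀ ℓ ℓ′ → InS' m (stepBetween ℓ ℓ′) → Step ℓ ℓ′
  InS′⇒Step (i , j) (i′ , j′) (inj₁ (a≡ , b≤)) =
    inj₂ (⊖≡+⁻ i′ i m a≡ , subst (j′ ≤_) (+-identityʳ j) (⊖≤+⁻ j′ j 0 b≤))
  InS′⇒Step (i , j) (i′ , j′) (inj₂ (a≤ , b≤)) =
    inj₁ (subst (suc i′ ≤_) (sym (+m≡suc+m∸1 i)) (s≤s (⊖≤+⁻ i′ i (m ∸ 1) (subst (i′ ⊖ i ℤ.≤_) (+m-+1 m≥1) a≤))) ,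
          subst (j′ ≤_) (+-comm j 1) (⊖≤+⁻ j′ j 1 b≤))

  WalkFrom : ℕ × ℕ → List Pt → Set
  WalkFrom ℓ S = All (InS' m) S × All InN2 (points (point ℓ) S)

  unwind : ℕ → List ℕ × List ℕ → List Pt → List Pt
  unwind zero    J acc = acc
  unwind (suc k) J acc = unwind k (shrinkInterval J) (stepBetween (label (shrinkInterval J)) (label J) ∷ acc)

  replay : List ℕ × List ℕ → List Pt → List ℕ × List ℕ
  replay J []      = J
  replay J (s ∷ S) = replay (growInterval J (move (label J) s)) S

  WalkFrom-head : ∀ ℓ s S → WalkFrom ℓ (s ∷ S) → let ℓ′ = move ℓ s in
    Step ℓ ℓ′ × WalkFrom ℓ′ S × stepBetween ℓ ℓ′ ≡ s × point ℓ′ ≡ point ℓ ⊕ s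
  WalkFrom-head ℓ s S (s∈S′ ∷ S∈S′ , _ ∷ inN2) = InS′⇒Step ℓ ℓ′ (subst (InS' m) (sym back) s∈S′) ,
    (S∈S′ , subst (λ p → All InN2 (points p S)) (sym moved) inN2) , back , moved
    where
    ℓ′ = move ℓ s
    here : InN2 (point ℓ ⊕ s)
    here = All-points-start (point ℓ ⊕ s) S inN2
    moved : point ℓ′ ≡ point ℓ ⊕ s
    moved = point-move ℓ s here
    back : stepBetween ℓ ℓ′ ≡ s
    back = stepBetween-move ℓ s here

  unwind-replay : ∀ S k J acc → CodeInterval (suc k) J → WalkFrom (label J) S →
                  unwind (length S + k) (replay J S) acc ≡ unwind k J (S ++ acc)
  unwind-replay []      k J acc I w = refl
  unwind-replay (s ∷ S) k J acc I w with WalkFrom-head (label J) s S w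
  ... | step , w′ , back , _ with growInterval-correct k J (move (label J) s) I step
  ...   | I′ , shrunk , labelled = begin
    unwind (suc (length S + k)) (replay J′ S) acc
      ≡⟨ cong (λ x → unwind x (replay J′ S) acc) (sym (+-suc (length S) k)) ⟩
    unwind (length S + suc k) (replay J′ S) acc
      ≡⟨ unwind-replay S (suc k) J′ acc I′ (subst (λ ℓ → WalkFrom ℓ S) (sym labelled) w′) ⟩
    unwind k (shrinkInterval J′) (stepBetween (label (shrinkInterval J′)) (label J′) ∷ S ++ acc)
      ≡⟨ cong₂ (λ A t → unwind k A (t ∷ S ++ acc)) shrunk
               (trans (cong₂ stepBetween (cong label shrunk) labelled) back) ⟩
    unwind k J (s ∷ S ++ acc) ∎
    where
    open ≡-Reasoning
    J′ = growInterval J (move (label J) s)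

  replay-unwind : ∀ k J acc → CodeInterval (suc k) J → replay baseInterval (unwind k J acc) ≡ replay J acc
  replay-unwind zero    J acc I = cong (λ w → replay w acc) (sym (CodeInterval-one J I))
  replay-unwind (suc k) J acc I = begin
    replay baseInterval (unwind k J′ (stepBetween (label J′) (label J) ∷ acc))
      ≡⟨ replay-unwind k J′ _ (shrinkInterval-CodeInterval k J I) ⟩
    replay (growInterval J′ (move (label J′) (stepBetween (label J′) (label J)))) acc
      ≡⟨ cong (λ ℓ → replay (growInterval J′ ℓ) acc) (move-stepBetween (label J′) (label J)) ⟩
    replay (growInterval J′ (label J)) acc
      ≡⟨ cong (λ w → replay w acc) (growInterval-shrinkInterval k J I) ⟩
    replay J acc ∎
    where
    open ≡-Reasoning
    J′ = shrinkInterval J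

  replay-CodeInterval : ∀ S k J → CodeInterval (suc k) J → WalkFrom (label J) S →
    CodeInterval (suc (length S + k)) (replay J S) × point (label (replay J S)) ≡ endpoint (point (label J)) S
  replay-CodeInterval []      k J I w = I , refl
  replay-CodeInterval (s ∷ S) k J I w with WalkFrom-head (label J) s S w
  ... | step , w′ , _ , moved with growInterval-correct k J (move (label J) s) I step
  ...   | I′ , _ , labelled with replay-CodeInterval S (suc k) (growInterval J (move (label J) s)) I′
                                 (subst (λ ℓ → WalkFrom ℓ S) (sym labelled) w′)
  ...     | I″ , ends = subst (λ x → CodeInterval (suc x) (replay (growInterval J (move (label J) s)) S))
                               (+-suc (length S) k) I″ ,
                        trans ends (cong (λ p → endpoint p S) (trans (cong point labelled) moved))

  unwind-walk : ∀ k J acc → CodeInterval (suc k) J → WalkFrom (label J) acc →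
    WalkFrom (0 , 0) (unwind k J acc) × length (unwind k J acc) ≡ k + length acc ×
    endpoint origin (unwind k J acc) ≡ endpoint (point (label J)) acc
  unwind-walk zero J acc I w =
    subst (λ ℓ → WalkFrom ℓ acc) base w , refl , cong (λ ℓ → endpoint (point ℓ) acc) (sym base)
    where
    base : label J ≡ (0 , 0)
    base = trans (cong label (CodeInterval-one J I)) label-baseInterval
  unwind-walk (suc k) J acc I (acc∈S′ , inN2)
    with unwind-walk k J′ (t ∷ acc) (shrinkInterval-CodeInterval k J I)
           (Step⇒InS′ _ _ (shrinkInterval-Step k J I) ∷ acc∈S′ ,
            (+≤+ z≤n , +≤+ z≤n) ∷
              subst (λ p → All InN2 (points p acc)) (sym (point-stepBetween (label J′) (label J))) inN2)
    where
    J′ = shrinkInterval J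
    t  = stepBetween (label J′) (label J)
  ... | w′ , len , ends = w′ , trans len (+-suc k (length acc)) ,
                          trans ends (cong (λ p → endpoint p acc) (point-stepBetween (label (shrinkInterval J)) (label J)))

  module _ (n : ℕ) where

    N : ℕ
    N = m * suc n

    -- The proof fields of Walk and Interval are irrelevant, so equations derived from them are
    -- recovered below with recompute.
    walkOf : ∀ S → .(WalkFrom (0 , 0) S × length S ≡ n) → Walk m n
    walkOf S w = walk S (proj₂ w) (proj₁ (proj₁ w)) (proj₂ (proj₁ w))

    intervalOf : ∀ J → .(CodeInterval (suc n) J) → Interval m (suc n)
    intervalOf (lP , lQ) I =
      interval (decode lP N) (decode lQ N) (decode-InD′ n lP (proj₁ I)) (decode-InD′ n lQ (proj₁ (proj₂ I)))
                                      (decode-≤D n lP lQ (proj₁ I) (proj₁ (proj₂ I)) (proj₂ (proj₂ I)))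

    unwind-interval : ∀ P Q → InD' m (suc n) P → InD' m (suc n) Q → P ≤D Q →
      let S = unwind n (code P , code Q) [] in
      (WalkFrom (0 , 0) S × length S ≡ n) × endpoint origin S ≡ point (label (code P , code Q))
    unwind-interval P Q inP inQ P≤Q
      with unwind-walk n (code P , code Q) [] (≤D⇒CodeInterval (suc n) P Q inP inQ P≤Q)
                       ([] , (+≤+ z≤n , +≤+ z≤n) ∷ [])
    ... | w , len , ends = (w , trans len (+-identityʳ n)) , ends

    replay-walk : ∀ S → WalkFrom (0 , 0) S × length S ≡ n → CodeInterval (suc n) (replay baseInterval S)
    replay-walk S (w , len) =
      subst (λ x → CodeInterval (suc x) (replay baseInterval S)) (trans (+-identityʳ (length S)) len)
        (proj₁ (replay-CodeInterval S 0 baseInterval baseInterval-CodeInterval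
                  (subst (λ ℓ → WalkFrom ℓ S) (sym label-baseInterval) w)))

    toWalk : Interval m (suc n) → Walk m n
    toWalk (interval P Q inP inQ P≤Q) = walkOf (unwind n (code P , code Q) []) (proj₁ (unwind-interval P Q inP inQ P≤Q))

    fromWalk : Walk m n → Interval m (suc n)
    fromWalk (walk S len S∈S′ inN2) = intervalOf (replay baseInterval S) (replay-walk S ((S∈S′ , inN2) , len))

    unwind-replay-walk : ∀ S → WalkFrom (0 , 0) S × length S ≡ n → unwind n (replay baseInterval S) [] ≡ S
    unwind-replay-walk S (w , len) = begin
      unwind n (replay baseInterval S) []
        ≡⟨ cong (λ x → unwind x (replay baseInterval S) []) (sym (trans (+-identityʳ (length S)) len)) ⟩
      unwind (length S + 0) (replay baseInterval S) []
        ≡⟨ unwind-replay S 0 baseInterval [] baseInterval-CodeInterval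
             (subst (λ ℓ → WalkFrom ℓ S) (sym label-baseInterval) w) ⟩
      S ++ []
        ≡⟨ ++-identityʳ S ⟩
      S ∎
      where open ≡-Reasoning

    code-decode-pair : ∀ J → CodeInterval (suc n) J → (code (decode (proj₁ J) N) , code (decode (proj₂ J) N)) ≡ J
    code-decode-pair (lP , lQ) (cP , cQ , _) = cong₂ _,_ (code-decode n lP cP) (code-decode n lQ cQ)

    toWalk-fromWalk : ∀ w → toWalk (fromWalk w) ≡ w
    toWalk-fromWalk (walk S len S∈S′ inN2) = walk-ext (recompute (≡-dec Pt-≟ _ _)
      (trans (cong (λ J → unwind n J []) (code-decode-pair (replay baseInterval S) (replay-walk S ((S∈S′ , inN2) , len))))
             (unwind-replay-walk S ((S∈S′ , inN2) , len))))

    decode-replay-unwind : ∀ P Q → InD' m (suc n) P → InD' m (suc n) Q → P ≤D Q →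
      let J = replay baseInterval (unwind n (code P , code Q) []) in decode (proj₁ J) N ≡ P × decode (proj₂ J) N ≡ Q
    decode-replay-unwind P Q inP inQ P≤Q =
      trans (cong (λ J → decode (proj₁ J) N) replayed) (decode-code (suc n) P inP) ,
      trans (cong (λ J → decode (proj₂ J) N) replayed) (decode-code (suc n) Q inQ)
      where
      replayed : replay baseInterval (unwind n (code P , code Q) []) ≡ (code P , code Q)
      replayed = replay-unwind n (code P , code Q) [] (≤D⇒CodeInterval (suc n) P Q inP inQ P≤Q)

    fromWalk-toWalk : ∀ I → fromWalk (toWalk I) ≡ I
    fromWalk-toWalk (interval P Q inP inQ P≤Q) =
      interval-ext (recompute (≡-dec Bool._≟_ _ _) (proj₁ (decode-replay-unwind P Q inP inQ P≤Q)))
                   (recompute (≡-dec Bool._≟_ _ _) (proj₂ (decode-replay-unwind P Q inP inQ P≤Q)))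

    Interval↔Walk : Interval m (suc n) ↔ Walk m n
    Interval↔Walk = mk↔ₛ′ toWalk fromWalk toWalk-fromWalk fromWalk-toWalk

    toWalk-end : ∀ I i j → walkEnd (toWalk I) ≡ (+ i , + j) →
                 (firstAscent (bot I) ≡ m + i) × IsR (bot I) (top I) (1 + j)
    toWalk-end (interval P Q inP inQ P≤Q) i j end =
      subst (λ x → firstAscent P ≡ m + x) i≡ (recompute (_ ≟ _) (firstAscent-label n P Q inP)) ,
      subst (λ x → IsR P Q (1 + x)) j≡ (recompute (IsR? P Q _) (IsR-label n P Q inP inQ P≤Q))
      where
      label≡ : point (label (code P , code Q)) ≡ (+ i , + j)
      label≡ = trans (sym (recompute (Pt-≟ _ _) (proj₂ (unwind-interval P Q inP inQ P≤Q)))) end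
      i≡ : proj₁ (label (code P , code Q)) ≡ i
      i≡ = ℤ.+-injective (cong proj₁ label≡)
      j≡ : proj₂ (label (code P , code Q)) ≡ j
      j≡ = ℤ.+-injective (cong proj₂ label≡)

corollary4p7 : (m n : ℕ) → 1 ≤ m → 1 ≤ n →
    (Σ[ φ ∈ Interval m n ⤖ Walk m (n ∸ 1) ]
      ((I : Interval m n) (i j : ℕ) →
        walkEnd (Bijection.to φ I) ≡ (+ i , + j) →
        (firstAscent (bot I) ≡ m + i) × IsR (bot I) (top I) (1 + j)))
    × (Interval m n ⤖ Excursion m n)
corollary4p7 m (suc n) m≥1 _ =
  (↔⇒⤖ (Interval↔Walk n) , toWalk-end n) , ↔⇒⤖ (Walk↔Excursion m m≥1 n ↔-∘ Interval↔Walk n)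
  where open WalkBijection m m≥1
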